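{- Let $0\le l<n$. Define $f$ on the cover relations of $R_{n,l}$ as follows. Let $x=(A_1,\dots,A_{l+1})\in R_{n,l}$ and $a\in[n]\setminus(A_1\cup\cdots\cup A_{l+1})$, and consider the elements $y\gtrdot x$ obtained from $x$ by adding $a$ to some block (there are one or two of them). If there is exactly one such $y$, set $f(x\lessdot y):=1$. Otherwise $\max(A_i)<a<\min(A_{i+1})$ for some $1\le i\le l$; letting $y_1$ (resp. $y_2$) be obtained by adding $a$ to $A_i$ (resp. $A_{i+1}$), set $$f(x\lessdot y_1):=\frac{|A_1\cup\cdots\cup A_i|}{|A_1\cup\cdots\cup A_{l+1}|},\qquad f(x\lessdot y_2):=\frac{|A_{i+1}\cup\cdots\cup A_{l+1}|}{|A_1\cup\cdots\cup A_{l+1}|}.$$ Then $f$ is a normalized flow on $R_{n,l}$.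
   Context: $R_{n,l}$ is the poset whose elements are $(l+1)$-tuples $(A_1,\dots,A_{l+1})$ of nonempty subsets of $[n]=\{1,\dots,n\}$ with $\max(A_i)<\min(A_{i+1})$ for all $i\in[l]$, ordered by componentwise containment; ranks are labeled $1$ to $d=n-l$, the rank of $(A_1,\dots,A_{l+1})$ being $|A_1\cup\cdots\cup A_{l+1}|-l$. The covers of $x$ are exactly the tuples obtained by adding one element $a$ (not in any block) to one block while preserving the condition $\max(A_i)<\min(A_{i+1})$. A normalized flow on a finite graded poset $P$ with ranks $1,\dots,d$ is a function $f$ from cover relations to $\mathbb{R}_{\ge0}$ such that for each $1\le r\le d-1$: (NF1) $\sum_{y:\,x\lessdot y}f(x\lessdot y)$ is the same positive number for all $x$ of rank $r$; and (NF2) $\sum_{x:\,x\lessdot y}f(x\lessdot y)$ is the same positive number for all $y$ of rank $r+1$. -}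

module Defs where

open import Data.Nat as ℕ using (ℕ; zero; suc; _∸_; _≤_)
open import Data.Integer using (+_)
open import Data.Fin using (Fin; toℕ; inject₁) renaming (suc to fsuc; _<_ to _<ᶠ_)
open import Data.Fin.Properties using (any?; all?)
open import Data.Fin.Subset using (Subset; _∈_; _∉_; _∪_; _─_; ⁅_⁆; ⋃; ∣_∣; Nonempty)
open import Data.Fin.Subset.Properties using (_∈?_; nonempty?)
open import Data.Vec as Vec using (Vec; _[_]%=_; lookup; toList)
import Data.Vec.Properties as VecP
open import Data.Bool using () renaming (_≟_ to _≟ᵇ_)
open import Data.List as List using (List; filter; deduplicate; length; map; foldr; concatMap)
open import Data.Rational as ℚ using (ℚ; 0ℚ; 1ℚ; _/_; _+_)
open import Data.Product using (Σ; _×_; _,_; ∃-syntax)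
open import Relation.Nullary using (Dec; yes; no; ¬?; ¬_)
open import Relation.Nullary.Decidable using (_×-dec_; _→-dec_)
open import Relation.Binary.PropositionalEquality using (_≡_)
open import Data.Nat using (_<_) renaming (_<?_ to _<ℕ?_)

Blocks : ℕ → ℕ → Set
Blocks n l = Vec (Subset n) (suc l)

_≟B_ : ∀ {n l} → (x y : Blocks n l) → Dec (x ≡ y)
_≟B_ = VecP.≡-dec (VecP.≡-dec _≟ᵇ_)

⋃B : ∀ {n l} → Blocks n l → Subset n
⋃B x = ⋃ (toList x)

-- max(A_i) < min(A_{i+1}) for all i ∈ [l] (written out: every element of
-- A_i is smaller than every element of A_{i+1}; blocks are nonempty)
Ordered : ∀ {n l} → Blocks n l → Set
Ordered {n} {l} x = ∀ (i : Fin l) (a b : Fin n) →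
  a ∈ lookup x (inject₁ i) → b ∈ lookup x (fsuc i) → a <ᶠ b

IsElem : ∀ {n l} → Blocks n l → Set
IsElem x = (∀ i → Nonempty (lookup x i)) × Ordered x

isElem? : ∀ {n l} (x : Blocks n l) → Dec (IsElem x)
isElem? x = all? (λ i → nonempty? (lookup x i))
  ×-dec all? (λ i → all? (λ a → all? (λ b →
          (a ∈? lookup x (inject₁ i)) →-dec ((b ∈? lookup x (fsuc i)) →-dec (toℕ a <ℕ? toℕ b)))))

rank : ∀ {n l} → Blocks n l → ℕ
rank {l = l} x = ∣ ⋃B x ∣ ∸ l

addTo : ∀ {n l} → Blocks n l → Fin n → Fin (suc l) → Blocks n l
addTo x a i = x [ i ]%= (_∪ ⁅ a ⁆)

removeFrom : ∀ {n l} → Blocks n l → Fin n → Fin (suc l) → Blocks n l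
removeFrom x a i = x [ i ]%= (_─ ⁅ a ⁆)

Cover : ∀ {n l} → Blocks n l → Blocks n l → Set
Cover {n} {l} x y = IsElem x × IsElem y ×
  (∃[ a ] ∃[ i ] (a ∉ ⋃B x × y ≡ addTo x a i))

cover? : ∀ {n l} (x y : Blocks n l) → Dec (Cover x y)
cover? x y = isElem? x ×-dec (isElem? y ×-dec
  any? (λ a → any? (λ i → ¬? (a ∈? ⋃B x) ×-dec (y ≟B addTo x a i))))

pairs : ∀ {n l} → List (Fin n × Fin (suc l))
pairs {n} {l} = concatMap (λ a → map (a ,_) (List.allFin (suc l))) (List.allFin n)

upCovers : ∀ {n l} → Blocks n l → List (Blocks n l)
upCovers x = deduplicate _≟B_
  (filter (cover? x) (map (λ { (a , i) → addTo x a i }) pairs))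

downCovers : ∀ {n l} → Blocks n l → List (Blocks n l)
downCovers y = deduplicate _≟B_
  (filter (λ x → cover? x y) (map (λ { (a , i) → removeFrom y a i }) pairs))

sumℚ : List ℚ → ℚ
sumℚ = foldr _+_ 0ℚ

-- Normalized flow on R_{n,l} (ranks 1,…,d with d = n − l).

IsNormalizedFlow : (n l : ℕ) → (Blocks n l → Blocks n l → ℚ) → Set
IsNormalizedFlow n l f =
  (∀ x y → Cover x y → 0ℚ ℚ.≤ f x y) ×
  (∀ r → 1 ≤ r → r ≤ (n ∸ l) ∸ 1 →
     Σ ℚ λ c → 0ℚ ℚ.< c ×
       (∀ x → IsElem x → rank x ≡ r → sumℚ (map (f x) (upCovers x)) ≡ c)) ×
  (∀ r → 1 ≤ r → r ≤ (n ∸ l) ∸ 1 →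
     Σ ℚ λ c → 0ℚ ℚ.< c ×
       (∀ y → IsElem y → rank y ≡ suc r → sumℚ (map (λ x → f x y) (downCovers y)) ≡ c))

-- p / N as a rational (N is |A₁ ∪ ⋯ ∪ A_{l+1}| ≥ 1 for elements of R_{n,l};
-- the zero case never arises and is given the dummy value 0).
frac : ℕ → ℕ → ℚ
frac p zero    = 0ℚ
frac p (suc m) = + p / suc m

validBlocks : ∀ {n l} → Blocks n l → Fin n → List (Fin (suc l))
validBlocks x a = filter (λ j → isElem? (addTo x a j)) (List.allFin _)

-- |A_1 ∪ ⋯ ∪ A_i|  and  |A_i ∪ ⋯ ∪ A_{l+1}|  (i : Fin (suc l), 0-indexed)
lowerUnion : ∀ {n l} → Blocks n l → Fin (suc l) → Subset n
lowerUnion x i = ⋃ (map (lookup x) (filter (λ j → toℕ j ℕ.≤? toℕ i) (List.allFin _)))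

upperUnion : ∀ {n l} → Blocks n l → Fin (suc l) → Subset n
upperUnion x i = ⋃ (map (lookup x) (filter (λ j → toℕ i ℕ.≤? toℕ j) (List.allFin _)))

fAdd : ∀ {n l} → Blocks n l → Fin n → Fin (suc l) → ℚ
fAdd x a i with length (validBlocks x a) ℕ.≟ 1
... | yes _ = 1ℚ
... | no _ with any? (λ j → (toℕ i <ℕ? toℕ j) ×-dec isElem? (addTo x a j))
...   | yes _ = frac ∣ lowerUnion x i ∣ ∣ ⋃B x ∣   -- y₁: a added to the lower block A_i
...   | no _  = frac ∣ upperUnion x i ∣ ∣ ⋃B x ∣   -- y₂: a added to the upper block A_{i+1}

-- f on pairs; only its values on cover relations matter (0 elsewhere)
flowR : (n l : ℕ) → Blocks n l → Blocks n l → ℚ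
flowR n l x y with cover? x y
... | yes (_ , _ , a , i , _) = fAdd x a i
... | no _ = 0ℚ

-- Write U for A₁ ∪ ⋯ ∪ A_{l+1}.  Out of x, every a ∉ U can be inserted either into a single
-- block (value 1) or into two adjacent blocks A_i, A_{i+1}; then the two values add up to 1,
-- because A₁ ∪ ⋯ ∪ A_i and A_{i+1} ∪ ⋯ ∪ A_{l+1} partition U.  So the flow out of x is n − |U|.
-- Into y, with |U| = N + 1, removing a from its block gives a cover x ⋖ y unless the block is
-- {a}, and N · f(x ⋖ y) = N − D(a), where D(a) is the number of elements above a when a is the
-- maximum of a block other than the last, plus the number below a when a is the minimum of a block
-- other than the first; when the block is {a}, D(a) = N.  Each e ∈ U is counted in D once for every
-- block other than its own (through the maximum of each earlier and the minimum of each later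
-- block), so ∑ₐ D(a) = (N + 1) l and the flow into y is (N + 1)(N − l) / N.

module Submission where

open import Algebra.Bundles using (CommutativeMonoid)
import Algebra.Properties.CommutativeMonoid.Sum as MonoidSum
open import Data.Bool using (true; false; if_then_else_)
open import Data.Empty using (⊥-elim)
open import Data.Fin as Fin using (Fin; toℕ; inject₁; punchIn; punchOut) renaming (zero to fzero; suc to fsuc)
import Data.Fin.Properties as FP
open import Data.Fin.Subset
  using (Subset; Nonempty; ∁; _∈_; _∉_; _⊆_; _∪_; _─_; ⁅_⁆; ⋃; ∣_∣; inside; outside)
open import Data.Fin.Subset.Properties
  using ( _∈?_; ∉⊥; x∈p∪q⁻; x∈p∪q⁺; x∈⁅x⁆; x∈⁅y⁆⇒x≡y; p─q⊆p; x∈p∧x∉q⇒x∈p─q; ⊆-antisym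
        ; ∣⁅x⁆∣≡1; p⊆q⇒∣p∣≤∣q∣; ∣∁p∣≡n∸∣p∣; x∈p⇒x∉∁p; x∉p⇒x∈∁p)
open import Data.Integer as ℤ using (+_)
import Data.Integer.Properties as ℤP
open import Data.List as List
  using (List; []; _∷_; _++_; length; map; filter; tabulate; concatMap; deduplicate; allFin; cartesianProduct)
import Data.List.Properties as LP
open import Data.List.Membership.Propositional using () renaming (_∈_ to _∈ₗ_)
open import Data.List.Membership.Propositional.Properties using (∈-map⁻; ∈-map⁺; ∈-filter⁻; ∈-filter⁺; ∈-allFin)
open import Data.List.Relation.Unary.All using (All; []; _∷_)
open import Data.List.Relation.Unary.AllPairs using ([]; _∷_)
import Data.List.Relation.Unary.Any as Any
open import Data.List.Relation.Unary.Unique.Propositional using (Unique)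
import Data.List.Relation.Unary.Unique.Propositional.Properties as UniqueP
open import Data.Nat as ℕ using (ℕ; zero; suc; _+_; _*_; _∸_; _<_; _≤_; z≤n; s≤s)
import Data.Nat.Properties as NP
open import Data.Nat.Tactic.RingSolver using (solve-∀)
open import Data.Integer.Tactic.RingSolver using () renaming (solve-∀ to ℤ-solve-∀)
open import Algebra.Properties.Semiring.Sum NP.+-*-semiring using (*-distribˡ-sum)
open import Data.Product using (Σ; _×_; _,_; proj₁; proj₂; ∃-syntax)
open import Data.Rational as ℚ using (ℚ; 0ℚ; 1ℚ)
import Data.Rational.Properties as QP
import Data.Rational.Unnormalised as ℚᵘ
import Data.Rational.Unnormalised.Properties as ℚᵘP
open import Data.Sum using (_⊎_; inj₁; inj₂; [_,_]′)
open import Data.Vec as Vec using ([]; _∷_; lookup; toList; here; there)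
open import Data.Vec.Membership.Propositional.Properties using (∈-toList⁻; ∈-toList⁺; ∈-lookup)
import Data.Vec.Properties as VP
open import Data.Vec.Relation.Binary.Pointwise.Extensional using (ext; Pointwise-≡⇒≡)
import Data.Vec.Relation.Unary.Any as VecAny
open import Data.Vec.Relation.Unary.Any.Properties using (lookup-index)
open import Function using (_∘_; id)
open import Relation.Binary using (DecidableEquality; tri<; tri≈; tri>)
open import Relation.Binary.PropositionalEquality
  using (_≡_; _≢_; refl; sym; trans; cong; cong₂; subst; module ≡-Reasoning)
open import Relation.Nullary using (Dec; yes; no; ¬_; ¬?; does; _×-dec_; _→-dec_)
open import Relation.Unary using (Pred; Decidable)

open import Defs

variable
  n l : ℕ

module FinSum {c ℓ} (M : CommutativeMonoid c ℓ) where

  open CommutativeMonoid M using (Carrier; _≈_; setoid; ∙-congˡ; identityʳ)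
    renaming (_∙_ to _+ᴹ_; ε to 0#; trans to ≈-trans)
  open MonoidSum M public using (sum; sum-cong-≗; ∑-distrib-+; ∑-comm; sum-remove)
  open MonoidSum M using (sum-cong-≋; sum-replicate-zero)
  open import Relation.Binary.Reasoning.Setoid setoid

  sum-zero : ∀ {m} (f : Fin m → Carrier) → (∀ i → f i ≈ 0#) → sum f ≈ 0#
  sum-zero {m} f f≈0 = ≈-trans (sum-cong-≋ f≈0) (sum-replicate-zero m)

  sum-point : ∀ {m} (f : Fin m → Carrier) j → (∀ i → i ≢ j → f i ≈ 0#) → sum f ≈ f j
  sum-point {suc m} f j f≈0 = begin
    sum f                              ≈⟨ sum-remove f ⟩
    f j +ᴹ sum (λ i → f (punchIn j i)) ≈⟨ ∙-congˡ (sum-zero _ (λ i → f≈0 _ (FP.punchInᵢ≢i j i))) ⟩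
    f j +ᴹ 0#                          ≈⟨ identityʳ (f j) ⟩
    f j                                ∎

  sum-pair : ∀ {m} (f : Fin m → Carrier) j k → j ≢ k →
             (∀ i → i ≢ j → i ≢ k → f i ≈ 0#) → sum f ≈ f j +ᴹ f k
  sum-pair {suc m} f j k j≢k f≈0 = begin
    sum f                                  ≈⟨ sum-remove f ⟩
    f j +ᴹ sum (λ i → f (punchIn j i))     ≈⟨ ∙-congˡ (sum-point _ (punchOut j≢k) zero-off-k) ⟩
    f j +ᴹ f (punchIn j (punchOut j≢k))    ≡⟨ cong (λ i → f j +ᴹ f i) (FP.punchIn-punchOut j≢k) ⟩
    f j +ᴹ f k                             ∎
    where
    zero-off-k : ∀ i → i ≢ punchOut j≢k → f (punchIn j i) ≈ 0#
    zero-off-k i i≢ = f≈0 _ (FP.punchInᵢ≢i j i)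
      (λ eq → i≢ (FP.punchIn-injective j i _ (trans eq (sym (FP.punchIn-punchOut j≢k)))))

module ℕSum = FinSum NP.+-0-commutativeMonoid
module ℚSum = FinSum QP.+-0-commutativeMonoid
open ℕSum using () renaming (sum to ∑ℕ)
open ℚSum using () renaming (sum to ∑ℚ)

𝟙 : ∀ {p} {P : Set p} → Dec P → ℕ
𝟙 d = if does d then 1 else 0

module _ {p} {P : Set p} where

  𝟙-yes : (d : Dec P) → P → 𝟙 d ≡ 1
  𝟙-yes (yes _) _  = refl
  𝟙-yes (no ¬p) p = ⊥-elim (¬p p)

  𝟙-no : (d : Dec P) → ¬ P → 𝟙 d ≡ 0
  𝟙-no (yes p) ¬p = ⊥-elim (¬p p)
  𝟙-no (no _)  _  = refl

  𝟙-*-≤ : (d : Dec P) (z : ℕ) → 𝟙 d * z ≤ z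
  𝟙-*-≤ (yes _) z = NP.≤-reflexive (NP.+-identityʳ z)
  𝟙-*-≤ (no _)  z = z≤n

  when : Dec P → ℚ → ℚ
  when d q = if does d then q else 0ℚ

  when-yes : (d : Dec P) (q : ℚ) → P → when d q ≡ q
  when-yes (yes _) q _  = refl
  when-yes (no ¬p) q p = ⊥-elim (¬p p)

  when-no : (d : Dec P) (q : ℚ) → ¬ P → when d q ≡ 0ℚ
  when-no (yes p) q ¬p = ⊥-elim (¬p p)
  when-no (no _)  q _  = refl

𝟙-×-dec : ∀ {p q} {P : Set p} {Q : Set q} (d : Dec P) (e : Dec Q) → 𝟙 (d ×-dec e) ≡ 𝟙 d * 𝟙 e
𝟙-×-dec (yes _) (yes _) = refl
𝟙-×-dec (yes _) (no _)  = refl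
𝟙-×-dec (no _)  (yes _) = refl
𝟙-×-dec (no _)  (no _)  = refl

module _ {m p} {P : Pred (Fin m) p} (P? : Decidable P) where

  ∑𝟙-unique : ∀ j → P j → (∀ k → P k → k ≡ j) → ∑ℕ (λ k → 𝟙 (P? k)) ≡ 1
  ∑𝟙-unique j pj unique = trans
    (ℕSum.sum-point _ j (λ k k≢j → 𝟙-no (P? k) (λ pk → k≢j (unique k pk))))
    (𝟙-yes (P? j) pj)

  ∑𝟙-none : (∀ k → ¬ P k) → ∑ℕ (λ k → 𝟙 (P? k)) ≡ 0
  ∑𝟙-none none = ℕSum.sum-zero _ (λ k → 𝟙-no (P? k) (none k))

∑ℕ-*ʳ : ∀ {m} c (f : Fin m → ℕ) → ∑ℕ (λ i → f i * c) ≡ ∑ℕ f * c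
∑ℕ-*ʳ c f = trans (ℕSum.sum-cong-≗ (λ i → NP.*-comm (f i) c))
                  (trans (sym (*-distribˡ-sum c f)) (NP.*-comm c (∑ℕ f)))

∑ℕ-ones : ∀ m → ∑ℕ {m} (λ _ → 1) ≡ m
∑ℕ-ones zero    = refl
∑ℕ-ones (suc m) = cong suc (∑ℕ-ones m)

m∸n≡1+r⇒m≡1+r+n : ∀ m n {r} → m ∸ n ≡ suc r → m ≡ suc r + n
m∸n≡1+r⇒m≡1+r+n m       zero    m≡1+r = trans m≡1+r (sym (NP.+-identityʳ _))
m∸n≡1+r⇒m≡1+r+n (suc m) (suc n) eq    = trans (cong suc (m∸n≡1+r⇒m≡1+r+n m n eq)) (sym (NP.+-suc _ n))

r+l<n : ∀ {n l r} → l < n → r ≤ n ∸ l ∸ 1 → r + l < n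
r+l<n {n} {l} {r} l<n r≤ = begin-strict
  r + l          ≤⟨ NP.+-monoˡ-≤ l r≤ ⟩
  n ∸ l ∸ 1 + l  <⟨ NP.+-monoˡ-< l (NP.∸-monoʳ-< {o = 0} (s≤s z≤n) (NP.m<n⇒0<n∸m l<n)) ⟩
  n ∸ l ∸ 0 + l  ≡⟨ NP.m∸n+n≡m (NP.<⇒≤ l<n) ⟩
  n              ∎
  where open NP.≤-Reasoning

∃-least : ∀ {m p} {P : Pred (Fin m) p} → Decidable P → ∀ i → P i →
          ∃[ k ] (P k × (∀ j → toℕ j < toℕ k → ¬ P j))
∃-least {suc m} P? i pi with P? fzero
... | yes p0 = fzero , p0 , λ _ ()
∃-least {suc m} P? fzero    pi | no ¬p0 = ⊥-elim (¬p0 pi)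
∃-least {suc m} P? (fsuc i) pi | no ¬p0 with k , pk , below ← ∃-least (λ j → P? (fsuc j)) i pi =
  fsuc k , pk , λ { fzero _ → ¬p0 ; (fsuc j) (s≤s j<k) → below j j<k }

∃-greatest : ∀ {m p} {P : Pred (Fin m) p} → Decidable P → ∀ i → P i →
             ∃[ k ] (P k × (∀ j → toℕ k < toℕ j → ¬ P j))
∃-greatest {suc m} P? i pi with FP.any? (λ j → P? (fsuc j))
... | yes (j , pj) with k , pk , above ← ∃-greatest (λ j → P? (fsuc j)) j pj =
  fsuc k , pk , λ { (fsuc j) (s≤s k<j) → above j k<j }
∃-greatest {suc m} P? fzero    pi | no none = fzero , pi , λ { (fsuc j) _ pj → none (j , pj) }
∃-greatest {suc m} P? (fsuc i) pi | no none = ⊥-elim (none (i , pi))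

suc-toℕ-pred : ∀ (i : Fin (suc n)) → 0 < toℕ i → suc (toℕ (Fin.pred i)) ≡ toℕ i
suc-toℕ-pred (fsuc i) _ = cong suc (FP.toℕ-inject₁ i)

frac-+ : ∀ p q N → frac p N ℚ.+ frac q N ≡ frac (p + q) N
frac-+ p q zero    = QP.+-identityˡ 0ℚ
frac-+ p q (suc k) = QP.toℚᵘ-injective (begin
  ℚ.toℚᵘ (frac p d ℚ.+ frac q d)                  ≈⟨ QP.toℚᵘ-homo-+ (frac p d) (frac q d) ⟩
  ℚ.toℚᵘ (frac p d) ℚᵘ.+ ℚ.toℚᵘ (frac q d)        ≈⟨ ℚᵘP.+-cong (QP.toℚᵘ-fromℚᵘ (ℚᵘ.mkℚᵘ (+ p) k))
                                                                (QP.toℚᵘ-fromℚᵘ (ℚᵘ.mkℚᵘ (+ q) k)) ⟩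
  ℚᵘ.mkℚᵘ (+ p) k ℚᵘ.+ ℚᵘ.mkℚᵘ (+ q) k            ≈⟨ ℚᵘ.*≡* cross-multiplied ⟩
  ℚᵘ.mkℚᵘ (+ (p + q)) k                           ≈⟨ QP.toℚᵘ-fromℚᵘ (ℚᵘ.mkℚᵘ (+ (p + q)) k) ⟨
  ℚ.toℚᵘ (frac (p + q) d)                         ∎)
  where
  open ℚᵘP.≃-Reasoning
  d = suc k
  common-denominator : ∀ p q d → (p ℤ.* d ℤ.+ q ℤ.* d) ℤ.* d ≡ (p ℤ.+ q) ℤ.* (d ℤ.* d)
  common-denominator = ℤ-solve-∀
  cross-multiplied : (+ p ℤ.* + d ℤ.+ + q ℤ.* + d) ℤ.* + d ≡ + (p + q) ℤ.* + (d * d)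
  cross-multiplied = trans (common-denominator (+ p) (+ q) (+ d))
                           (sym (cong₂ ℤ._*_ (ℤP.pos-+ p q) (ℤP.pos-* d d)))

frac-zero : ∀ N → frac 0 N ≡ 0ℚ
frac-zero zero    = refl
frac-zero (suc k) = QP.0/n≡0 (suc k)

frac-self : ∀ {N} → 0 < N → frac N N ≡ 1ℚ
frac-self {suc k} _ =
  QP.fromℚᵘ-cong {ℚᵘ.mkℚᵘ (+ suc k) k} {ℚᵘ.mkℚᵘ (+ 1) 0} (ℚᵘ.*≡* (ℤP.*-comm (+ suc k) (+ 1)))

frac-nonneg : ∀ p N → 0ℚ ℚ.≤ frac p N
frac-nonneg p zero    = QP.≤-refl
frac-nonneg p (suc k) = QP.nonNegative⁻¹ (frac p (suc k)) {{QP.normalize-nonNeg p (suc k)}}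

frac-pos : ∀ p N → 0 < p → 0 < N → 0ℚ ℚ.< frac p N
frac-pos (suc p) (suc k) _ _ = QP.positive⁻¹ (frac (suc p) (suc k)) {{QP.normalize-pos (suc p) (suc k)}}

∑ℚ-frac : ∀ {m} (c : Fin m → ℕ) N → ∑ℚ (λ a → frac (c a) N) ≡ frac (∑ℕ c) N
∑ℚ-frac {zero}  c N = sym (frac-zero N)
∑ℚ-frac {suc m} c N = trans (cong (frac (c fzero) N ℚ.+_) (∑ℚ-frac (λ a → c (fsuc a)) N))
                            (frac-+ (c fzero) _ N)

sumℚ-++ : ∀ xs ys → sumℚ (xs ++ ys) ≡ sumℚ xs ℚ.+ sumℚ ys
sumℚ-++ []       ys = sym (QP.+-identityˡ _)
sumℚ-++ (x ∷ xs) ys = trans (cong (x ℚ.+_) (sumℚ-++ xs ys)) (sym (QP.+-assoc x _ _))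

sumℚ-map-tabulate : ∀ {a m} {A : Set a} (f : A → ℚ) (g : Fin m → A) →
                    sumℚ (map f (tabulate g)) ≡ ∑ℚ (λ i → f (g i))
sumℚ-map-tabulate {m = zero}  f g = refl
sumℚ-map-tabulate {m = suc m} f g = cong (f (g fzero) ℚ.+_) (sumℚ-map-tabulate f (λ i → g (fsuc i)))

module _ {a} {A : Set a} where

  sumℚ-filter : ∀ {p} {P : Pred A p} (P? : Decidable P) (h : A → ℚ) xs →
                sumℚ (map h (filter P? xs)) ≡ sumℚ (map (λ z → when (P? z) (h z)) xs)
  sumℚ-filter P? h []       = refl
  sumℚ-filter P? h (x ∷ xs) with does (P? x)
  ... | true  = cong (h x ℚ.+_) (sumℚ-filter P? h xs)
  ... | false = trans (sumℚ-filter P? h xs) (sym (QP.+-identityˡ _))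

  deduplicate-unique : (_≟_ : DecidableEquality A) → ∀ xs → Unique xs → deduplicate _≟_ xs ≡ xs
  deduplicate-unique _≟_ []       []         = refl
  deduplicate-unique _≟_ (x ∷ xs) (x∉ ∷ xs!) rewrite deduplicate-unique _≟_ xs xs! =
    cong (x ∷_) (LP.filter-all _ x∉)

module _ {a b} {A : Set a} {B : Set b} where

  sumℚ-concatMap : (h : B → ℚ) (F : A → List B) (xs : List A) →
                   sumℚ (map h (concatMap F xs)) ≡ sumℚ (map (λ z → sumℚ (map h (F z))) xs)
  sumℚ-concatMap h F []       = refl
  sumℚ-concatMap h F (x ∷ xs) = begin
    sumℚ (map h (F x ++ concatMap F xs))            ≡⟨ cong sumℚ (LP.map-++ h (F x) _) ⟩
    sumℚ (map h (F x) ++ map h (concatMap F xs))    ≡⟨ sumℚ-++ (map h (F x)) _ ⟩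
    sumℚ (map h (F x)) ℚ.+ sumℚ (map h (concatMap F xs))
                                                    ≡⟨ cong (sumℚ (map h (F x)) ℚ.+_) (sumℚ-concatMap h F xs) ⟩
    sumℚ (map (λ z → sumℚ (map h (F z))) (x ∷ xs))  ∎
    where open ≡-Reasoning

  module _ {p} {P : Pred B p} (P? : Decidable P) (g : A → B)
           (injective : ∀ u v → P (g u) → P (g v) → g u ≡ g v → u ≡ v) where

    unique-filter-map : ∀ xs → Unique xs → Unique (filter P? (map g xs))
    unique-filter-map []       []          = []
    unique-filter-map (x ∷ xs) (x∉ ∷ xs!) with P? (g x)
    ... | yes px = distinct xs px x∉ ∷ unique-filter-map xs xs!
      where
      distinct : ∀ vs → P (g x) → All (x ≢_) vs → All (g x ≢_) (filter P? (map g vs))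
      distinct []       _  []          = []
      distinct (v ∷ vs) px (x≢v ∷ x∉) with P? (g v)
      ... | yes pv = (λ eq → x≢v (injective x v px pv eq)) ∷ distinct vs px x∉
      ... | no  _  = distinct vs px x∉
    ... | no  _  = unique-filter-map xs xs!

length-filter-tabulate : ∀ {a p m} {A : Set a} {P : Pred A p} (P? : Decidable P) (f : Fin m → A) →
                         length (filter P? (tabulate f)) ≡ ∑ℕ (λ k → 𝟙 (P? (f k)))
length-filter-tabulate {m = zero}  P? f = refl
length-filter-tabulate {m = suc m} P? f with does (P? (f fzero))
... | true  = cong suc (length-filter-tabulate P? (λ k → f (fsuc k)))
... | false = length-filter-tabulate P? (λ k → f (fsuc k))

module _ {m p} {P : Pred (Fin m) p} (P? : Decidable P) where

  length-filter-allFin≡1 : ∀ j → P j → (∀ k → P k → k ≡ j) → length (filter P? (allFin m)) ≡ 1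
  length-filter-allFin≡1 j pj unique = trans (length-filter-tabulate P? id) (∑𝟙-unique P? j pj unique)

  length-filter-allFin≢1 : ∀ j k → P j → P k → j ≢ k → length (filter P? (allFin m)) ≢ 1
  length-filter-allFin≢1 j k pj pk j≢k length≡1
    with filter P? (allFin m) | ∈-filter⁺ P? (∈-allFin j) pj | ∈-filter⁺ P? (∈-allFin k) pk
  ... | _ ∷ [] | Any.here j≡ | Any.here k≡ = j≢k (trans j≡ (sym k≡))

pairs-unique : Unique (pairs {n} {l})
pairs-unique {n} {l} = subst Unique (sym (concatMap≡cartesianProduct (allFin n)))
  (UniqueP.cartesianProduct⁺ (UniqueP.allFin⁺ n) (UniqueP.allFin⁺ (suc l)))
  where
  concatMap≡cartesianProduct : ∀ xs →
    concatMap (λ a → map (a ,_) (allFin (suc l))) xs ≡ cartesianProduct xs (allFin (suc l))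
  concatMap≡cartesianProduct []       = refl
  concatMap≡cartesianProduct (x ∷ xs) = cong (map (x ,_) (allFin (suc l)) ++_) (concatMap≡cartesianProduct xs)

sumℚ-pairs : (h : Fin n × Fin (suc l) → ℚ) →
             sumℚ (map h (pairs {n} {l})) ≡ ∑ℚ (λ a → ∑ℚ (λ i → h (a , i)))
sumℚ-pairs {n} {l} h = begin
  sumℚ (map h (concatMap row (allFin n)))           ≡⟨ sumℚ-concatMap h row (allFin n) ⟩
  sumℚ (map (λ a → sumℚ (map h (row a))) (allFin n)) ≡⟨ sumℚ-map-tabulate (λ a → sumℚ (map h (row a))) id ⟩
  ∑ℚ (λ a → sumℚ (map h (row a)))                   ≡⟨ ℚSum.sum-cong-≗ sum-row ⟩
  ∑ℚ (λ a → ∑ℚ (λ i → h (a , i)))                   ∎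
  where
  open ≡-Reasoning
  row : Fin n → List (Fin n × Fin (suc l))
  row a = map (a ,_) (allFin (suc l))
  sum-row : ∀ a → sumℚ (map h (row a)) ≡ ∑ℚ (λ i → h (a , i))
  sum-row a = trans (cong sumℚ (sym (LP.map-∘ {g = h} {f = a ,_} (allFin (suc l)))))
                    (sumℚ-map-tabulate (λ i → h (a , i)) id)

-- The injectivity hypothesis is stated on pairs (a , i) so that g (a , i) reduces when g is the
-- pattern-matching lambda of upCovers and downCovers.
sumℚ-filter-pairs : ∀ {c p} {C : Set c} {P : Pred C p} (_≟_ : DecidableEquality C) (P? : Decidable P)
  (g : Fin n × Fin (suc l) → C) (F : C → ℚ) →
  (∀ a i b j → P (g (a , i)) → P (g (b , j)) → g (a , i) ≡ g (b , j) → a ≡ b × i ≡ j) →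
  sumℚ (map F (deduplicate _≟_ (filter P? (map g pairs)))) ≡
  ∑ℚ (λ a → ∑ℚ (λ i → when (P? (g (a , i))) (F (g (a , i)))))
sumℚ-filter-pairs {n} {l} {P = P} _≟_ P? g F injective = begin
  sumℚ (map F (deduplicate _≟_ (filter P? (map g pairs))))
    ≡⟨ cong (sumℚ ∘ map F) (deduplicate-unique _≟_ _ (unique-filter-map P? g injective′ pairs pairs-unique)) ⟩
  sumℚ (map F (filter P? (map g pairs)))             ≡⟨ sumℚ-filter P? F (map g pairs) ⟩
  sumℚ (map (λ z → when (P? z) (F z)) (map g pairs))
    ≡⟨ cong sumℚ (LP.map-∘ {g = λ z → when (P? z) (F z)} {f = g} pairs) ⟨
  sumℚ (map (λ u → when (P? (g u)) (F (g u))) pairs)  ≡⟨ sumℚ-pairs (λ u → when (P? (g u)) (F (g u))) ⟩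
  ∑ℚ (λ a → ∑ℚ (λ i → when (P? (g (a , i))) (F (g (a , i))))) ∎
  where
  open ≡-Reasoning
  injective′ : ∀ u v → P (g u) → P (g v) → g u ≡ g v → u ≡ v
  injective′ (a , i) (b , j) pu pv eq with refl , refl ← injective a i b j pu pv eq = refl

χ : Subset n → Fin n → ℕ
χ s e = 𝟙 (e ∈? s)

∣p∣≡∑χ : (s : Subset n) → ∣ s ∣ ≡ ∑ℕ (χ s)
∣p∣≡∑χ []            = refl
∣p∣≡∑χ (inside ∷ s)  = cong suc (∣p∣≡∑χ s)
∣p∣≡∑χ (outside ∷ s) = ∣p∣≡∑χ s

χ-∈ : ∀ {e : Fin n} {s} → e ∈ s → χ s e ≡ 1
χ-∈ {e = e} {s} = 𝟙-yes (e ∈? s)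

χ-∉ : ∀ {e : Fin n} {s} → e ∉ s → χ s e ≡ 0
χ-∉ {e = e} {s} = 𝟙-no (e ∈? s)

∣p∣+∣q∣≡∣r∣ : (p q r : Subset n) → (∀ {e} → e ∈ p → e ∉ q) → (∀ {e} → e ∈ r → e ∈ p ⊎ e ∈ q) →
              p ⊆ r → q ⊆ r → ∣ p ∣ + ∣ q ∣ ≡ ∣ r ∣
∣p∣+∣q∣≡∣r∣ p q r disjoint covers p⊆r q⊆r = begin
  ∣ p ∣ + ∣ q ∣                ≡⟨ cong₂ _+_ (∣p∣≡∑χ p) (∣p∣≡∑χ q) ⟩
  ∑ℕ (χ p) + ∑ℕ (χ q)          ≡⟨ ℕSum.∑-distrib-+ (χ p) (χ q) ⟨
  ∑ℕ (λ e → χ p e + χ q e)     ≡⟨ ℕSum.sum-cong-≗ pointwise ⟩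
  ∑ℕ (χ r)                     ≡⟨ ∣p∣≡∑χ r ⟨
  ∣ r ∣                        ∎
  where
  open ≡-Reasoning
  pointwise : ∀ e → χ p e + χ q e ≡ χ r e
  pointwise e with e ∈? p | e ∈? q
  ... | yes e∈p | yes e∈q = ⊥-elim (disjoint e∈p e∈q)
  ... | yes e∈p | no _    = sym (χ-∈ (p⊆r e∈p))
  ... | no _    | yes e∈q = sym (χ-∈ (q⊆r e∈q))
  ... | no e∉p  | no e∉q  = sym (χ-∉ (λ e∈r → [ e∉p , e∉q ]′ (covers e∈r)))

∣p∣≡∑χ∧ : ∀ {q} {Q : Pred (Fin n) q} (Q? : Decidable Q) (p r : Subset n) →
          (∀ {e} → e ∈ p → e ∈ r × Q e) → (∀ {e} → e ∈ r → Q e → e ∈ p) →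
          ∣ p ∣ ≡ ∑ℕ (λ e → χ r e * 𝟙 (Q? e))
∣p∣≡∑χ∧ Q? p r sound complete = trans (∣p∣≡∑χ p) (ℕSum.sum-cong-≗ pointwise)
  where
  pointwise : ∀ e → χ p e ≡ χ r e * 𝟙 (Q? e)
  pointwise e with e ∈? p | e ∈? r | Q? e
  ... | yes _   | yes _   | yes _   = refl
  ... | yes e∈p | no e∉r  | _       = ⊥-elim (e∉r (proj₁ (sound e∈p)))
  ... | yes e∈p | _       | no ¬qe  = ⊥-elim (¬qe (proj₂ (sound e∈p)))
  ... | no e∉p  | yes e∈r | yes qe  = ⊥-elim (e∉p (complete e∈r qe))
  ... | no _    | yes _   | no _    = refl
  ... | no _    | no _    | _       = refl

x∈p─q⇒x∉q : ∀ {x : Fin n} (p q : Subset n) → x ∈ p ─ q → x ∉ q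
x∈p─q⇒x∉q (inside ∷ p)  (outside ∷ q) here      ()
x∈p─q⇒x∉q (_ ∷ p)       (_ ∷ q)       (there x∈) (there x∈q) = x∈p─q⇒x∉q p q x∈ x∈q

x∈⋃⁻ : ∀ {x : Fin n} ss → x ∈ ⋃ ss → ∃[ s ] (s ∈ₗ ss × x ∈ s)
x∈⋃⁻ []       x∈ = ⊥-elim (∉⊥ x∈)
x∈⋃⁻ (s ∷ ss) x∈ with x∈p∪q⁻ s (⋃ ss) x∈
... | inj₁ x∈s = s , Any.here refl , x∈s
... | inj₂ x∈⋃ with t , t∈ , x∈t ← x∈⋃⁻ ss x∈⋃ = t , Any.there t∈ , x∈t

x∈⋃⁺ : ∀ {x : Fin n} {s} ss → s ∈ₗ ss → x ∈ s → x ∈ ⋃ ss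
x∈⋃⁺ (s ∷ ss) (Any.here refl) x∈ = x∈p∪q⁺ (inj₁ x∈)
x∈⋃⁺ (t ∷ ss) (Any.there s∈)  x∈ = x∈p∪q⁺ {p = t} (inj₂ (x∈⋃⁺ ss s∈ x∈))

∈-⋃B⁻ : ∀ {e : Fin n} (x : Blocks n l) → e ∈ ⋃B x → ∃[ i ] e ∈ lookup x i
∈-⋃B⁻ x e∈ with s , s∈ , e∈s ← x∈⋃⁻ (toList x) e∈ =
  let s∈x = ∈-toList⁻ s∈ in VecAny.index s∈x , subst (_ ∈_) (lookup-index s∈x) e∈s

∈-⋃B⁺ : ∀ {e : Fin n} (x : Blocks n l) i → e ∈ lookup x i → e ∈ ⋃B x
∈-⋃B⁺ x i = x∈⋃⁺ (toList x) (∈-toList⁺ (∈-lookup i x))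

module _ {p} {P : Pred (Fin (suc l)) p} (P? : Decidable P) (x : Blocks n l) where

  ∈-⋃-blocks⁻ : ∀ {e} → e ∈ ⋃ (map (lookup x) (filter P? (allFin _))) → ∃[ i ] (P i × e ∈ lookup x i)
  ∈-⋃-blocks⁻ e∈ with x∈⋃⁻ (map (lookup x) (filter P? (allFin _))) e∈
  ... | s , s∈ , e∈s with ∈-map⁻ (lookup x) s∈
  ...   | i , i∈ , refl =
    i , proj₂ (∈-filter⁻ P? i∈) , e∈s

  ∈-⋃-blocks⁺ : ∀ {e} i → P i → e ∈ lookup x i → e ∈ ⋃ (map (lookup x) (filter P? (allFin _)))
  ∈-⋃-blocks⁺ i pi =
    x∈⋃⁺ (map (lookup x) (filter P? (allFin _))) (∈-map⁺ (lookup x) (∈-filter⁺ P? (∈-allFin i) pi))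

∈-lowerUnion⁻ : ∀ {e : Fin n} (x : Blocks n l) j → e ∈ lowerUnion x j →
                ∃[ i ] (toℕ i ≤ toℕ j × e ∈ lookup x i)
∈-lowerUnion⁻ x j = ∈-⋃-blocks⁻ (λ i → toℕ i ℕ.≤? toℕ j) x

∈-lowerUnion⁺ : ∀ {e : Fin n} (x : Blocks n l) j i → toℕ i ≤ toℕ j → e ∈ lookup x i → e ∈ lowerUnion x j
∈-lowerUnion⁺ x j = ∈-⋃-blocks⁺ (λ i → toℕ i ℕ.≤? toℕ j) x

∈-upperUnion⁻ : ∀ {e : Fin n} (x : Blocks n l) j → e ∈ upperUnion x j →
                ∃[ i ] (toℕ j ≤ toℕ i × e ∈ lookup x i)
∈-upperUnion⁻ x j = ∈-⋃-blocks⁻ (λ i → toℕ j ℕ.≤? toℕ i) x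

∈-upperUnion⁺ : ∀ {e : Fin n} (x : Blocks n l) j i → toℕ j ≤ toℕ i → e ∈ lookup x i → e ∈ upperUnion x j
∈-upperUnion⁺ x j = ∈-⋃-blocks⁺ (λ i → toℕ j ℕ.≤? toℕ i) x

lookup-addTo : ∀ (x : Blocks n l) a j → lookup (addTo x a j) j ≡ lookup x j ∪ ⁅ a ⁆
lookup-addTo x a j = VP.lookup∘updateAt j x

lookup-addTo-other : ∀ (x : Blocks n l) a j i → i ≢ j → lookup (addTo x a j) i ≡ lookup x i
lookup-addTo-other x a j i i≢j = VP.lookup∘updateAt′ i j i≢j x

lookup-removeFrom : ∀ (x : Blocks n l) a j → lookup (removeFrom x a j) j ≡ lookup x j ─ ⁅ a ⁆
lookup-removeFrom x a j = VP.lookup∘updateAt j x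

lookup-removeFrom-other : ∀ (x : Blocks n l) a j i → i ≢ j → lookup (removeFrom x a j) i ≡ lookup x i
lookup-removeFrom-other x a j i i≢j = VP.lookup∘updateAt′ i j i≢j x

∈-addTo⁻ : ∀ {e} (x : Blocks n l) a k i → e ∈ lookup (addTo x a k) i → e ∈ lookup x i ⊎ (i ≡ k × e ≡ a)
∈-addTo⁻ x a k i e∈ with i FP.≟ k
... | no i≢k = inj₁ (subst (_ ∈_) (lookup-addTo-other x a k i i≢k) e∈)
... | yes refl with x∈p∪q⁻ (lookup x k) ⁅ a ⁆ (subst (_ ∈_) (lookup-addTo x a k) e∈)
...   | inj₁ e∈x = inj₁ e∈x
...   | inj₂ e∈a = inj₂ (refl , x∈⁅y⁆⇒x≡y a e∈a)

∈-addTo⁺ : ∀ {e} (x : Blocks n l) a k i → e ∈ lookup x i → e ∈ lookup (addTo x a k) i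
∈-addTo⁺ x a k i e∈ with i FP.≟ k
... | yes refl = subst (_ ∈_) (sym (lookup-addTo x a k)) (x∈p∪q⁺ (inj₁ e∈))
... | no i≢k   = subst (_ ∈_) (sym (lookup-addTo-other x a k i i≢k)) e∈

∈-addTo-new : ∀ (x : Blocks n l) a k → a ∈ lookup (addTo x a k) k
∈-addTo-new x a k = subst (a ∈_) (sym (lookup-addTo x a k)) (x∈p∪q⁺ {p = lookup x k} (inj₂ (x∈⁅x⁆ a)))

∈-removeFrom⁻ : ∀ {e} (y : Blocks n l) a β i → e ∈ lookup (removeFrom y a β) i →
                e ∈ lookup y i × (i ≡ β → e ≢ a)
∈-removeFrom⁻ y a β i e∈ with i FP.≟ β
... | no i≢β   = subst (_ ∈_) (lookup-removeFrom-other y a β i i≢β) e∈ , λ i≡β → ⊥-elim (i≢β i≡β)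
... | yes refl = let e∈─ = subst (_ ∈_) (lookup-removeFrom y a β) e∈ in
  p─q⊆p (lookup y β) ⁅ a ⁆ e∈─ , λ { _ refl → x∈p─q⇒x∉q (lookup y β) ⁅ a ⁆ e∈─ (x∈⁅x⁆ a) }

∈-removeFrom⁺ : ∀ {e} (y : Blocks n l) a β i → e ∈ lookup y i → (i ≡ β → e ≢ a) →
                e ∈ lookup (removeFrom y a β) i
∈-removeFrom⁺ y a β i e∈ e≢a with i FP.≟ β
... | yes refl = subst (_ ∈_) (sym (lookup-removeFrom y a β))
                   (x∈p∧x∉q⇒x∈p─q e∈ (λ e∈a → e≢a refl (x∈⁅y⁆⇒x≡y a e∈a)))
... | no i≢β   = subst (_ ∈_) (sym (lookup-removeFrom-other y a β i i≢β)) e∈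

addTo-removeFrom : ∀ (y : Blocks n l) a β → a ∈ lookup y β → addTo (removeFrom y a β) a β ≡ y
addTo-removeFrom y a β a∈ = Pointwise-≡⇒≡ (ext same-block)
  where
  x = removeFrom y a β
  same-block : ∀ i → lookup (addTo x a β) i ≡ lookup y i
  same-block i with i FP.≟ β
  ... | no i≢β   = trans (lookup-addTo-other x a β i i≢β) (lookup-removeFrom-other y a β i i≢β)
  ... | yes refl = ⊆-antisym ⊆y y⊆
    where
    ⊆y : lookup (addTo x a β) β ⊆ lookup y β
    ⊆y e∈ with ∈-addTo⁻ x a β β e∈
    ... | inj₁ e∈x        = proj₁ (∈-removeFrom⁻ y a β β e∈x)
    ... | inj₂ (_ , refl) = a∈
    y⊆ : lookup y β ⊆ lookup (addTo x a β) β
    y⊆ {e} e∈ with e FP.≟ a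
    ... | yes refl = ∈-addTo-new x a β
    ... | no e≢a   = ∈-addTo⁺ x a β β (∈-removeFrom⁺ y a β β e∈ (λ _ → e≢a))

-- Elements of R_{n,l}

blocks-ordered : ∀ (x : Blocks n l) → IsElem x → ∀ i j → toℕ i < toℕ j →
                 ∀ {a b} → a ∈ lookup x i → b ∈ lookup x j → toℕ a < toℕ b
blocks-ordered {n} {l} x (nonempty , ordered) i j = go (toℕ j) j refl
  where
  go : ∀ k (j : Fin (suc l)) → toℕ j ≡ k → toℕ i < toℕ j →
       ∀ {a b} → a ∈ lookup x i → b ∈ lookup x j → toℕ a < toℕ b
  go (suc k) (fsuc j) j≡k (s≤s i≤j) {a} a∈ b∈ with NP.m≤n⇒m<n∨m≡n i≤j
  ... | inj₂ i≡j = ordered j a _ (subst (λ z → a ∈ lookup x z) i≡ĵ a∈) b∈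
    where i≡ĵ = FP.toℕ-injective (trans i≡j (sym (FP.toℕ-inject₁ j)))
  ... | inj₁ i<j with c , c∈ ← nonempty (inject₁ j) =
    NP.<-trans (go k (inject₁ j) (trans (FP.toℕ-inject₁ j) (NP.suc-injective j≡k))
                   (subst (toℕ i <_) (sym (FP.toℕ-inject₁ j)) i<j) a∈ c∈)
               (ordered j c _ c∈ b∈)

block-unique : ∀ (x : Blocks n l) → IsElem x → ∀ i j {e} → e ∈ lookup x i → e ∈ lookup x j → i ≡ j
block-unique x el i j e∈i e∈j with NP.<-cmp (toℕ i) (toℕ j)
... | tri< i<j _ _ = ⊥-elim (NP.<-irrefl refl (blocks-ordered x el i j i<j e∈i e∈j))
... | tri≈ _ i≡j _ = FP.toℕ-injective i≡j
... | tri> _ _ j<i = ⊥-elim (NP.<-irrefl refl (blocks-ordered x el j i j<i e∈j e∈i))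

Fits : Blocks n l → Fin n → Fin (suc l) → Set
Fits {l = l} x a k = ∀ (i : Fin (suc l)) {e} → e ∈ lookup x i →
  (toℕ i < toℕ k → toℕ e < toℕ a) × (toℕ k < toℕ i → toℕ a < toℕ e)

isElem-addTo⇒fits : ∀ (x : Blocks n l) a k → IsElem (addTo x a k) → Fits x a k
isElem-addTo⇒fits x a k el i e∈ =
  (λ i<k → blocks-ordered (addTo x a k) el i k i<k (∈-addTo⁺ x a k i e∈) (∈-addTo-new x a k)) ,
  (λ k<i → blocks-ordered (addTo x a k) el k i k<i (∈-addTo-new x a k) (∈-addTo⁺ x a k i e∈))

fits⇒isElem-addTo : ∀ (x : Blocks n l) a k → IsElem x → Fits x a k → IsElem (addTo x a k)
fits⇒isElem-addTo x a k (nonempty , ordered) fits =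
  (λ i → let c , c∈ = nonempty i in c , ∈-addTo⁺ x a k i c∈) , ordered′
  where
  ordered′ : Ordered (addTo x a k)
  ordered′ i e b e∈ b∈ with ∈-addTo⁻ x a k (inject₁ i) e∈ | ∈-addTo⁻ x a k (fsuc i) b∈
  ... | inj₁ e∈x | inj₁ b∈x = ordered i e b e∈x b∈x
  ... | inj₁ e∈x | inj₂ (refl , refl) = proj₁ (fits (inject₁ i) e∈x) (FP.≤̄⇒inject₁< NP.≤-refl)
  ... | inj₂ (refl , refl) | inj₁ b∈x = proj₂ (fits (fsuc i) b∈x) (FP.≤̄⇒inject₁< NP.≤-refl)
  ... | inj₂ (k≡ , _) | inj₂ (k≡′ , _) =
    ⊥-elim (NP.<-irrefl (cong toℕ (trans k≡ (sym k≡′))) (FP.≤̄⇒inject₁< NP.≤-refl))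

fits-adjacent : ∀ (x : Blocks n l) a → IsElem x → ∀ k k′ → Fits x a k → Fits x a k′ →
                toℕ k < toℕ k′ → toℕ k′ ≡ suc (toℕ k)
fits-adjacent {l = l} x a el k k′ fits-k fits-k′ k<k′ with toℕ k′ ℕ.≟ suc (toℕ k)
... | yes k′≡k+1 = k′≡k+1
... | no  k′≢k+1 = ⊥-elim (NP.<-asym (proj₁ (fits-k′ m c∈) m<k′) (proj₂ (fits-k m c∈) k<m))
  where
  k+1<k′ = NP.≤∧≢⇒< k<k′ (λ eq → k′≢k+1 (sym eq))
  m : Fin (suc l)
  m = Fin.fromℕ< (NP.<-trans k+1<k′ (FP.toℕ<n k′))
  m≡k+1 : toℕ m ≡ suc (toℕ k)
  m≡k+1 = FP.toℕ-fromℕ< (NP.<-trans k+1<k′ (FP.toℕ<n k′))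
  c∈ = proj₂ (proj₁ el m)
  m<k′ = subst (_< toℕ k′) (sym m≡k+1) k+1<k′
  k<m  = subst (toℕ k <_) (sym m≡k+1) (NP.n<1+n _)

module _ (x : Blocks n l) (a : Fin n) where

  private
    HasAbove : Fin (suc l) → Set
    HasAbove i = ∃[ e ] (e ∈ lookup x i × toℕ a < toℕ e)

    hasAbove? : Decidable HasAbove
    hasAbove? i = FP.any? (λ e → (e ∈? lookup x i) ×-dec (toℕ a ℕ.<? toℕ e))

    below : a ∉ ⋃B x → ∀ i {e} → e ∈ lookup x i → ¬ toℕ a < toℕ e → toℕ e < toℕ a
    below a∉ i e∈ a≮e = NP.≤∧≢⇒< (NP.≮⇒≥ a≮e)
      (λ e≡a → a∉ (subst (_∈ ⋃B x) (FP.toℕ-injective e≡a) (∈-⋃B⁺ x i e∈)))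

  fits-exists : IsElem x → a ∉ ⋃B x → ∃[ k ] Fits x a k
  fits-exists el a∉ with FP.any? hasAbove?
  ... | no none = Fin.fromℕ l , λ i e∈ →
    (λ _ → below a∉ i e∈ (λ a<e → none (i , _ , e∈ , a<e))) ,
    (λ l<i → ⊥-elim (NP.<⇒≱ l<i (subst (toℕ i ≤_) (sym (FP.toℕ-fromℕ l)) (FP.toℕ≤pred[n] i))))
  ... | yes (i₀ , above₀) with k , (c , c∈ , a<c) , least ← ∃-least hasAbove? i₀ above₀ =
    k , λ i e∈ →
    (λ i<k → below a∉ i e∈ (λ a<e → least i i<k (_ , e∈ , a<e))) ,
    (λ k<i → NP.<-trans a<c (blocks-ordered x el k i k<i c∈ e∈))

fits-pair-only : ∀ (x : Blocks n l) a → IsElem x → ∀ {p q k} → Fits x a p → Fits x a q → toℕ p < toℕ q →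
                 Fits x a k → k ≡ p ⊎ k ≡ q
fits-pair-only x a el {p} {q} {k} fits-p fits-q p<q fits-k with NP.<-cmp (toℕ k) (toℕ p)
... | tri< k<p _ _ = ⊥-elim (NP.<-irrefl (trans (fits-adjacent x a el k p fits-k fits-p k<p)
                                                (sym (fits-adjacent x a el k q fits-k fits-q (NP.<-trans k<p p<q))))
                                         p<q)
... | tri≈ _ k≡p _ = inj₁ (FP.toℕ-injective k≡p)
... | tri> _ _ p<k = inj₂ (FP.toℕ-injective (trans (fits-adjacent x a el p k fits-p fits-k p<k)
                                                   (sym (fits-adjacent x a el p q fits-p fits-q p<q))))

lowerUnion+upperUnion : ∀ (x : Blocks n l) p q → IsElem x → toℕ q ≡ suc (toℕ p) →
                        ∣ lowerUnion x p ∣ + ∣ upperUnion x q ∣ ≡ ∣ ⋃B x ∣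
lowerUnion+upperUnion x p q el q≡p+1 = ∣p∣+∣q∣≡∣r∣ _ _ _ disjoint covers lower⊆ upper⊆
  where
  disjoint : ∀ {e} → e ∈ lowerUnion x p → e ∉ upperUnion x q
  disjoint e∈ e∈′ with i , i≤p , e∈i ← ∈-lowerUnion⁻ x p e∈
                     | i′ , q≤i′ , e∈i′ ← ∈-upperUnion⁻ x q e∈′
    with refl ← block-unique x el i i′ e∈i e∈i′ =
    NP.<-irrefl refl (NP.≤-trans (s≤s i≤p) (subst (_≤ toℕ i) q≡p+1 q≤i′))
  covers : ∀ {e} → e ∈ ⋃B x → e ∈ lowerUnion x p ⊎ e ∈ upperUnion x q
  covers e∈ with i , e∈i ← ∈-⋃B⁻ x e∈ with toℕ i ℕ.≤? toℕ p
  ... | yes i≤p = inj₁ (∈-lowerUnion⁺ x p i i≤p e∈i)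
  ... | no  i≰p = inj₂ (∈-upperUnion⁺ x q i (subst (_≤ toℕ i) (sym q≡p+1) (NP.≰⇒> i≰p)) e∈i)
  lower⊆ : lowerUnion x p ⊆ ⋃B x
  lower⊆ e∈ = let i , _ , e∈i = ∈-lowerUnion⁻ x p e∈ in ∈-⋃B⁺ x i e∈i
  upper⊆ : upperUnion x q ⊆ ⋃B x
  upper⊆ e∈ = let i , _ , e∈i = ∈-upperUnion⁻ x q e∈ in ∈-⋃B⁺ x i e∈i

∣⋃B∣>0 : ∀ (x : Blocks n l) → IsElem x → 0 < ∣ ⋃B x ∣
∣⋃B∣>0 x (nonempty , _) with c , c∈ ← nonempty fzero =
  subst (_≤ ∣ ⋃B x ∣) (∣⁅x⁆∣≡1 c)
    (p⊆q⇒∣p∣≤∣q∣ (λ e∈ → subst (_∈ ⋃B x) (sym (x∈⁅y⁆⇒x≡y c e∈)) (∈-⋃B⁺ x fzero c∈)))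

-- Covers and the flow f

addTo-injective : ∀ (x : Blocks n l) {a a′ i i′} → a′ ∉ ⋃B x →
                  addTo x a i ≡ addTo x a′ i′ → a ≡ a′ × i ≡ i′
addTo-injective x {a} {a′} {i} {i′} a′∉ eq
  with ∈-addTo⁻ x a i i′ (subst (λ z → a′ ∈ lookup z i′) (sym eq) (∈-addTo-new x a′ i′))
... | inj₁ a′∈x          = ⊥-elim (a′∉ (∈-⋃B⁺ x i′ a′∈x))
... | inj₂ (refl , refl) = refl , refl

cover-addTo⇒∉ : ∀ (x : Blocks n l) a i → Cover x (addTo x a i) → a ∉ ⋃B x
cover-addTo⇒∉ x a i (_ , _ , a′ , i′ , a′∉ , eq) with refl , _ ← addTo-injective x a′∉ eq = a′∉

flowR-addTo : ∀ (x : Blocks n l) a i → Cover x (addTo x a i) → flowR n l x (addTo x a i) ≡ fAdd x a i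
flowR-addTo {n} {l} x a i c with cover? x (addTo x a i)
... | no ¬c = ⊥-elim (¬c c)
... | yes (_ , _ , a′ , i′ , a′∉ , eq) with refl , refl ← addTo-injective x a′∉ eq = refl

cover-removeFrom⇒∈ : ∀ (y : Blocks n l) a j → Cover (removeFrom y a j) y → a ∈ lookup y j
cover-removeFrom⇒∈ y a j (_ , _ , a′ , i′ , a′∉ , y≡)
  with a′∈y ← subst (λ z → a′ ∈ lookup z i′) (sym y≡) (∈-addTo-new (removeFrom y a j) a′ i′)
     | i′ FP.≟ j | a′ FP.≟ a
... | yes refl | yes refl = a′∈y
... | no i′≢j  | _        =
  ⊥-elim (a′∉ (∈-⋃B⁺ (removeFrom y a j) i′ (∈-removeFrom⁺ y a j i′ a′∈y (λ i′≡j → ⊥-elim (i′≢j i′≡j)))))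
... | yes _    | no a′≢a  =
  ⊥-elim (a′∉ (∈-⋃B⁺ (removeFrom y a j) i′ (∈-removeFrom⁺ y a j i′ a′∈y (λ _ → a′≢a))))

∉-removeFrom : ∀ (y : Blocks n l) a β → IsElem y → a ∈ lookup y β → a ∉ ⋃B (removeFrom y a β)
∉-removeFrom y a β ely a∈ a∈⋃ with i , a∈i ← ∈-⋃B⁻ (removeFrom y a β) a∈⋃
  with a∈y , kept ← ∈-removeFrom⁻ y a β i a∈i with refl ← block-unique y ely i β a∈y a∈ = kept refl refl

removeFrom-cover : ∀ (y : Blocks n l) a β → IsElem y → a ∈ lookup y β → IsElem (removeFrom y a β) →
                   Cover (removeFrom y a β) y
removeFrom-cover y a β ely a∈ elx = elx , ely , a , β , ∉-removeFrom y a β ely a∈ , sym (addTo-removeFrom y a β a∈)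

removeFrom-injective : ∀ (y : Blocks n l) {a b j k} → Cover (removeFrom y a j) y → Cover (removeFrom y b k) y →
                       removeFrom y a j ≡ removeFrom y b k → a ≡ b × j ≡ k
removeFrom-injective y {a} {b} {j} {k} ca cb eq = addTo-injective (removeFrom y a j) b∉ (begin
  addTo (removeFrom y a j) a j ≡⟨ addTo-removeFrom y a j (cover-removeFrom⇒∈ y a j ca) ⟩
  y                            ≡⟨ addTo-removeFrom y b k (cover-removeFrom⇒∈ y b k cb) ⟨
  addTo (removeFrom y b k) b k ≡⟨ cong (λ x → addTo x b k) eq ⟨
  addTo (removeFrom y a j) b k ∎)
  where
  open ≡-Reasoning
  b∉ = subst (λ x → b ∉ ⋃B x) (sym eq) (∉-removeFrom y b k (proj₁ (proj₂ cb)) (cover-removeFrom⇒∈ y b k cb))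

flowR-removeFrom : ∀ (y : Blocks n l) a j → Cover (removeFrom y a j) y →
                   flowR n l (removeFrom y a j) y ≡ fAdd (removeFrom y a j) a j
flowR-removeFrom {n} {l} y a j c with cover? (removeFrom y a j) y
... | no ¬c = ⊥-elim (¬c c)
... | yes (_ , _ , a′ , i′ , a′∉ , eq)
  with refl , refl ← addTo-injective _ a′∉ (trans (addTo-removeFrom y a j (cover-removeFrom⇒∈ y a j c)) eq) = refl

removeFrom-isElem : ∀ (y : Blocks n l) a β {e} → IsElem y → e ∈ lookup y β → e ≢ a → IsElem (removeFrom y a β)
removeFrom-isElem y a β {e} (nonempty , ordered) e∈ e≢a = nonempty′ , ordered′
  where
  nonempty′ : ∀ i → Nonempty (lookup (removeFrom y a β) i)
  nonempty′ i with i FP.≟ β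
  ... | yes refl = e , ∈-removeFrom⁺ y a β β e∈ (λ _ → e≢a)
  ... | no i≢β   = let c , c∈ = nonempty i in c , ∈-removeFrom⁺ y a β i c∈ (λ i≡β → ⊥-elim (i≢β i≡β))
  ordered′ : Ordered (removeFrom y a β)
  ordered′ i u v u∈ v∈ = ordered i u v (proj₁ (∈-removeFrom⁻ y a β _ u∈)) (proj₁ (∈-removeFrom⁻ y a β _ v∈))

module _ (x : Blocks n l) (a : Fin n) where

  fAdd-single : ∀ j → length (validBlocks x a) ≡ 1 → fAdd x a j ≡ 1ℚ
  fAdd-single j single with length (validBlocks x a) ℕ.≟ 1
  ... | yes _ = refl
  ... | no ¬single = ⊥-elim (¬single single)

  fAdd-lower : ∀ j k → length (validBlocks x a) ≢ 1 → IsElem (addTo x a k) → toℕ j < toℕ k →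
               fAdd x a j ≡ frac ∣ lowerUnion x j ∣ ∣ ⋃B x ∣
  fAdd-lower j k ¬single el j<k with length (validBlocks x a) ℕ.≟ 1
  ... | yes single = ⊥-elim (¬single single)
  ... | no _ with FP.any? (λ k → (toℕ j ℕ.<? toℕ k) ×-dec isElem? (addTo x a k))
  ...   | yes _   = refl
  ...   | no none = ⊥-elim (none (k , j<k , el))

  fAdd-upper : ∀ j → length (validBlocks x a) ≢ 1 → (∀ k → toℕ j < toℕ k → ¬ IsElem (addTo x a k)) →
               fAdd x a j ≡ frac ∣ upperUnion x j ∣ ∣ ⋃B x ∣
  fAdd-upper j ¬single none-above with length (validBlocks x a) ℕ.≟ 1
  ... | yes single = ⊥-elim (¬single single)
  ... | no _ with FP.any? (λ k → (toℕ j ℕ.<? toℕ k) ×-dec isElem? (addTo x a k))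
  ...   | yes (k , j<k , el) = ⊥-elim (none-above k j<k el)
  ...   | no _               = refl

fAdd-nonneg : ∀ (x : Blocks n l) a i → 0ℚ ℚ.≤ fAdd x a i
fAdd-nonneg x a i with length (validBlocks x a) ℕ.≟ 1
... | yes _ = frac-nonneg 1 1
... | no _ with FP.any? (λ j → (toℕ i ℕ.<? toℕ j) ×-dec isElem? (addTo x a j))
...   | yes _ = frac-nonneg (∣ lowerUnion x i ∣) (∣ ⋃B x ∣)
...   | no _  = frac-nonneg (∣ upperUnion x i ∣) (∣ ⋃B x ∣)

flowR-nonneg : ∀ (x y : Blocks n l) → 0ℚ ℚ.≤ flowR n l x y
flowR-nonneg x y with cover? x y
... | yes (_ , _ , a , i , _) = fAdd-nonneg x a i
... | no _                    = QP.≤-refl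

-- Total flow out of an element

module Outflow (x : Blocks n l) (el : IsElem x) where

  flowTo : Fin n → Fin (suc l) → ℚ
  flowTo a i = when (cover? x (addTo x a i)) (flowR n l x (addTo x a i))

  inserted : Fin n → Fin (suc l) → ℚ
  inserted a i = when (isElem? (addTo x a i)) (fAdd x a i)

  ∑-inserted-pair : ∀ {a} p q → toℕ p < toℕ q → IsElem (addTo x a p) → IsElem (addTo x a q) →
                    ∑ℚ (inserted a) ≡ 1ℚ
  ∑-inserted-pair {a} p q p<q el-p el-q = begin
    ∑ℚ (inserted a)                               ≡⟨ ℚSum.sum-pair (inserted a) p q p≢q zero-elsewhere ⟩
    inserted a p ℚ.+ inserted a q                 ≡⟨ cong₂ ℚ._+_ (when-yes (isElem? (addTo x a p)) _ el-p)
                                                                 (when-yes (isElem? (addTo x a q)) _ el-q) ⟩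
    fAdd x a p ℚ.+ fAdd x a q                     ≡⟨ cong₂ ℚ._+_ (fAdd-lower x a p q two el-q p<q)
                                                                 (fAdd-upper x a q two none-above) ⟩
    frac (∣ lowerUnion x p ∣) U ℚ.+ frac (∣ upperUnion x q ∣) U
                                                  ≡⟨ frac-+ (∣ lowerUnion x p ∣) (∣ upperUnion x q ∣) U ⟩
    frac (∣ lowerUnion x p ∣ + ∣ upperUnion x q ∣) U
                                                  ≡⟨ cong (λ z → frac z U) (lowerUnion+upperUnion x p q el q≡p+1) ⟩
    frac U U                                      ≡⟨ frac-self (∣⋃B∣>0 x el) ⟩
    1ℚ                                            ∎
    where
    open ≡-Reasoning
    U = ∣ ⋃B x ∣
    fits-p = isElem-addTo⇒fits x a p el-p
    fits-q = isElem-addTo⇒fits x a q el-q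
    q≡p+1 = fits-adjacent x a el p q fits-p fits-q p<q
    p≢q : p ≢ q
    p≢q refl = NP.<-irrefl refl p<q
    two : length (validBlocks x a) ≢ 1
    two = length-filter-allFin≢1 (λ k → isElem? (addTo x a k)) p q el-p el-q p≢q
    only : ∀ {k} → IsElem (addTo x a k) → k ≡ p ⊎ k ≡ q
    only {k} el-k = fits-pair-only x a el fits-p fits-q p<q (isElem-addTo⇒fits x a k el-k)
    none-above : ∀ k → toℕ q < toℕ k → ¬ IsElem (addTo x a k)
    none-above k q<k el-k with only el-k
    ... | inj₁ refl = NP.<-asym p<q q<k
    ... | inj₂ refl = NP.<-irrefl refl q<k
    zero-elsewhere : ∀ i → i ≢ p → i ≢ q → inserted a i ≡ 0ℚ
    zero-elsewhere i i≢p i≢q = when-no (isElem? (addTo x a i)) _ ([ i≢p , i≢q ]′ ∘ only)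

  ∑-inserted : ∀ {a} → a ∉ ⋃B x → ∑ℚ (inserted a) ≡ 1ℚ
  ∑-inserted {a} a∉ with j , fits-j ← fits-exists x a el a∉
    with FP.any? (λ k → ¬? (k FP.≟ j) ×-dec isElem? (addTo x a k))
  ... | no none = begin
    ∑ℚ (inserted a) ≡⟨ ℚSum.sum-point (inserted a) j
                         (λ i i≢j → when-no (isElem? (addTo x a i)) _ (i≢j ∘ unique i)) ⟩
    inserted a j    ≡⟨ when-yes (isElem? (addTo x a j)) _ el-j ⟩
    fAdd x a j      ≡⟨ fAdd-single x a j (length-filter-allFin≡1 (λ k → isElem? (addTo x a k)) j el-j unique) ⟩
    1ℚ              ∎
    where
    open ≡-Reasoning
    el-j = fits⇒isElem-addTo x a j el fits-j
    unique : ∀ k → IsElem (addTo x a k) → k ≡ j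
    unique k el-k with k FP.≟ j
    ... | yes k≡j = k≡j
    ... | no  k≢j = ⊥-elim (none (k , k≢j , el-k))
  ... | yes (k , k≢j , el-k) with NP.<-cmp (toℕ j) (toℕ k)
  ...   | tri< j<k _ _ = ∑-inserted-pair j k j<k (fits⇒isElem-addTo x a j el fits-j) el-k
  ...   | tri≈ _ j≡k _ = ⊥-elim (k≢j (FP.toℕ-injective (sym j≡k)))
  ...   | tri> _ _ k<j = ∑-inserted-pair k j k<j el-k (fits⇒isElem-addTo x a j el fits-j)

  flowTo≡inserted : ∀ {a} → a ∉ ⋃B x → ∀ i → flowTo a i ≡ inserted a i
  flowTo≡inserted {a} a∉ i = by-cases (isElem? (addTo x a i))
    where
    by-cases : Dec (IsElem (addTo x a i)) → flowTo a i ≡ inserted a i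
    by-cases (yes el′) = begin
      flowTo a i                ≡⟨ when-yes (cover? x (addTo x a i)) (flowR n l x (addTo x a i)) c ⟩
      flowR n l x (addTo x a i) ≡⟨ flowR-addTo x a i c ⟩
      fAdd x a i                ≡⟨ when-yes (isElem? (addTo x a i)) (fAdd x a i) el′ ⟨
      inserted a i              ∎
      where
      open ≡-Reasoning
      c = el , el′ , a , i , a∉ , refl
    by-cases (no ¬el′) = trans (when-no (cover? x (addTo x a i)) (flowR n l x (addTo x a i)) (¬el′ ∘ proj₁ ∘ proj₂))
                               (sym (when-no (isElem? (addTo x a i)) (fAdd x a i) ¬el′))

  ∑-flowTo : ∀ a → ∑ℚ (flowTo a) ≡ frac (χ (∁ (⋃B x)) a) 1
  ∑-flowTo a with a ∈? ⋃B x
  ... | yes a∈ = begin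
    ∑ℚ (flowTo a)           ≡⟨ ℚSum.sum-zero (flowTo a)
                                 (λ i → when-no (cover? x (addTo x a i)) _ (λ c → cover-addTo⇒∉ x a i c a∈)) ⟩
    0ℚ                      ≡⟨ frac-zero 1 ⟨
    frac 0 1                ≡⟨ cong (λ z → frac z 1) (χ-∉ (x∈p⇒x∉∁p a∈)) ⟨
    frac (χ (∁ (⋃B x)) a) 1 ∎
    where open ≡-Reasoning
  ... | no a∉ = begin
    ∑ℚ (flowTo a)           ≡⟨ ℚSum.sum-cong-≗ (flowTo≡inserted a∉) ⟩
    ∑ℚ (inserted a)         ≡⟨ ∑-inserted a∉ ⟩
    1ℚ                      ≡⟨ frac-self {1} (s≤s z≤n) ⟨
    frac 1 1                ≡⟨ cong (λ z → frac z 1) (χ-∈ (x∉p⇒x∈∁p a∉)) ⟨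
    frac (χ (∁ (⋃B x)) a) 1 ∎
    where open ≡-Reasoning

  outflow : sumℚ (map (flowR n l x) (upCovers x)) ≡ frac (n ∸ ∣ ⋃B x ∣) 1
  outflow = begin
    sumℚ (map (flowR n l x) (upCovers x)) ≡⟨ sumℚ-filter-pairs _≟B_ (cover? x) _ (flowR n l x) injective ⟩
    ∑ℚ (λ a → ∑ℚ (flowTo a))              ≡⟨ ℚSum.sum-cong-≗ ∑-flowTo ⟩
    ∑ℚ (λ a → frac (χ (∁ (⋃B x)) a) 1)    ≡⟨ ∑ℚ-frac (χ (∁ (⋃B x))) 1 ⟩
    frac (∑ℕ (χ (∁ (⋃B x)))) 1            ≡⟨ cong (λ z → frac z 1) (∣p∣≡∑χ (∁ (⋃B x))) ⟨
    frac (∣ ∁ (⋃B x) ∣) 1                 ≡⟨ cong (λ z → frac z 1) (∣∁p∣≡n∸∣p∣ (⋃B x)) ⟩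
    frac (n ∸ ∣ ⋃B x ∣) 1                 ∎
    where
    open ≡-Reasoning
    injective : ∀ a i b j → Cover x (addTo x a i) → Cover x (addTo x b j) →
                addTo x a i ≡ addTo x b j → a ≡ b × i ≡ j
    injective a i b j _ c eq = addTo-injective x (cover-addTo⇒∉ x b j c) eq

  outflow-of-rank : ∀ r → rank x ≡ suc r → sumℚ (map (flowR n l x) (upCovers x)) ≡ frac (n ∸ (suc r + l)) 1
  outflow-of-rank r rank≡ = trans outflow (cong (λ m → frac (n ∸ m) 1) (m∸n≡1+r⇒m≡1+r+n _ l rank≡))

-- Total flow into an element

module Inflow (y : Blocks n l) (ely : IsElem y) where

  U : Subset n
  U = ⋃B y

  N : ℕ
  N = ∣ U ∣ ∸ 1

  IsMaxOf IsMinOf : Fin (suc l) → Fin n → Set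
  IsMaxOf j a = a ∈ lookup y j × (∀ e → e ∈ lookup y j → toℕ e ≤ toℕ a)
  IsMinOf j a = a ∈ lookup y j × (∀ e → e ∈ lookup y j → toℕ a ≤ toℕ e)

  -- Removing such an a from y leaves two blocks into which it can be put back:
  -- y is then the lower (TopOf) or the upper (BottomOf) of the two covers.
  TopOf BottomOf : Fin (suc l) → Fin n → Set
  TopOf    j a = toℕ j < l × IsMaxOf j a
  BottomOf j a = 0 < toℕ j × IsMinOf j a

  topOf? : ∀ j a → Dec (TopOf j a)
  topOf? j a = (toℕ j ℕ.<? l) ×-dec (a ∈? lookup y j) ×-dec
               FP.all? (λ e → (e ∈? lookup y j) →-dec (toℕ e ℕ.≤? toℕ a))

  bottomOf? : ∀ j a → Dec (BottomOf j a)
  bottomOf? j a = (0 ℕ.<? toℕ j) ×-dec (a ∈? lookup y j) ×-dec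
                  FP.all? (λ e → (e ∈? lookup y j) →-dec (toℕ a ℕ.≤? toℕ e))

  max-unique : ∀ {j a b} → IsMaxOf j a → IsMaxOf j b → a ≡ b
  max-unique (a∈ , a-max) (b∈ , b-max) = FP.toℕ-injective (NP.≤-antisym (b-max _ a∈) (a-max _ b∈))

  min-unique : ∀ {j a b} → IsMinOf j a → IsMinOf j b → a ≡ b
  min-unique (a∈ , a-min) (b∈ , b-min) = FP.toℕ-injective (NP.≤-antisym (a-min _ b∈) (b-min _ a∈))

  max-exists : ∀ j → ∃[ a ] IsMaxOf j a
  max-exists j with c , c∈ ← proj₁ ely j with a , a∈ , none-above ← ∃-greatest (_∈? lookup y j) c c∈ =
    a , a∈ , λ e e∈ → NP.≮⇒≥ (λ a<e → none-above e a<e e∈)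

  min-exists : ∀ j → ∃[ a ] IsMinOf j a
  min-exists j with c , c∈ ← proj₁ ely j with a , a∈ , none-below ← ∃-least (_∈? lookup y j) c c∈ =
    a , a∈ , λ e e∈ → NP.≮⇒≥ (λ e<a → none-below e e<a e∈)

  above below : Fin n → ℕ
  above a = ∑ℕ (λ e → χ U e * 𝟙 (toℕ a ℕ.<? toℕ e))
  below a = ∑ℕ (λ e → χ U e * 𝟙 (toℕ e ℕ.<? toℕ a))

  below+above : ∀ {a} → a ∈ U → below a + above a ≡ N
  below+above {a} a∈ = sym (cong (_∸ 1) (begin
    ∣ U ∣                                 ≡⟨ ∣p∣≡∑χ U ⟩
    ∑ℕ (χ U)                              ≡⟨ ℕSum.sum-cong-≗ split ⟩
    ∑ℕ (λ e → (lt e + gt e) + is-a e)     ≡⟨ ℕSum.∑-distrib-+ (λ e → lt e + gt e) is-a ⟩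
    ∑ℕ (λ e → lt e + gt e) + ∑ℕ is-a      ≡⟨ cong₂ _+_ (ℕSum.∑-distrib-+ lt gt)
                                                       (∑𝟙-unique (FP._≟ a) a refl (λ _ e≡a → e≡a)) ⟩
    (below a + above a) + 1               ≡⟨ NP.+-comm _ 1 ⟩
    suc (below a + above a)               ∎))
    where
    open ≡-Reasoning
    lt gt is-a : Fin n → ℕ
    lt e   = χ U e * 𝟙 (toℕ e ℕ.<? toℕ a)
    gt e   = χ U e * 𝟙 (toℕ a ℕ.<? toℕ e)
    is-a e = 𝟙 (e FP.≟ a)
    split : ∀ e → χ U e ≡ (χ U e * 𝟙 (toℕ e ℕ.<? toℕ a) + χ U e * 𝟙 (toℕ a ℕ.<? toℕ e)) + 𝟙 (e FP.≟ a)
    split e with NP.<-cmp (toℕ e) (toℕ a)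
    ... | tri< e<a e≢a _ rewrite 𝟙-yes (toℕ e ℕ.<? toℕ a) e<a | 𝟙-no (toℕ a ℕ.<? toℕ e) (NP.<⇒≯ e<a)
                                | 𝟙-no (e FP.≟ a) (e≢a ∘ cong toℕ) = arithmetic (χ U e)
      where arithmetic : ∀ c → c ≡ (c * 1 + c * 0) + 0
            arithmetic = solve-∀
    ... | tri≈ _ e≡a _ with refl ← FP.toℕ-injective e≡a
      rewrite 𝟙-no (toℕ a ℕ.<? toℕ a) (NP.<-irrefl refl) | 𝟙-yes (a FP.≟ a) refl | χ-∈ a∈ = refl
    ... | tri> _ e≢a a<e rewrite 𝟙-no (toℕ e ℕ.<? toℕ a) (NP.<⇒≯ a<e) | 𝟙-yes (toℕ a ℕ.<? toℕ e) a<e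
                                | 𝟙-no (e FP.≟ a) (e≢a ∘ cong toℕ) = arithmetic (χ U e)
      where arithmetic : ∀ c → c ≡ (c * 0 + c * 1) + 0
            arithmetic = solve-∀

  topPair bottomPair : Fin (suc l) → Fin n → Fin n → ℕ
  topPair    j a e = 𝟙 (topOf? j a ×-dec (toℕ a ℕ.<? toℕ e))
  bottomPair j a e = 𝟙 (bottomOf? j a ×-dec (toℕ e ℕ.<? toℕ a))

  -- D(a) of the proof idea, written as a double sum so that the sum over a can be exchanged.
  defect : Fin n → ℕ
  defect a = ∑ℕ (λ j → ∑ℕ (λ e → χ U e * (topPair j a e + bottomPair j a e)))

  -- N · f(y − a ⋖ y); the subtraction is truncated, but defect a ≤ N for a ∈ U.
  weight : Fin n → ℕ
  weight a = χ U a * (N ∸ defect a)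

  topPairs-at : ∀ j k {e} → e ∈ lookup y k → ∑ℕ (λ a → topPair j a e) ≡ 𝟙 (toℕ j ℕ.<? toℕ k)
  topPairs-at j k {e} e∈ with toℕ j ℕ.<? toℕ k
  ... | yes j<k with a₀ , max₀ ← max-exists j = trans
    (∑𝟙-unique (λ a → topOf? j a ×-dec (toℕ a ℕ.<? toℕ e)) a₀
      ((NP.<-≤-trans j<k (FP.toℕ≤pred[n] k) , max₀) , blocks-ordered y ely j k j<k (proj₁ max₀) e∈)
      (λ a ((_ , max) , _) → max-unique max max₀))
    (sym (𝟙-yes (toℕ j ℕ.<? toℕ k) j<k))
  ... | no j≮k = trans
    (∑𝟙-none (λ a → topOf? j a ×-dec (toℕ a ℕ.<? toℕ e))
      (λ a ((_ , a∈ , a-max) , a<e) → NP.<⇒≱ a<e (e≤a a∈ a-max)))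
    (sym (𝟙-no (toℕ j ℕ.<? toℕ k) j≮k))
    where
    e≤a : ∀ {a} → a ∈ lookup y j → (∀ e → e ∈ lookup y j → toℕ e ≤ toℕ a) → toℕ e ≤ toℕ a
    e≤a a∈ a-max with NP.<-cmp (toℕ k) (toℕ j)
    ... | tri< k<j _ _ = NP.<⇒≤ (blocks-ordered y ely k j k<j e∈ a∈)
    ... | tri≈ _ k≡j _ = a-max _ (subst (λ z → e ∈ lookup y z) (FP.toℕ-injective k≡j) e∈)
    ... | tri> _ _ j<k = ⊥-elim (j≮k j<k)

  bottomPairs-at : ∀ j k {e} → e ∈ lookup y k → ∑ℕ (λ a → bottomPair j a e) ≡ 𝟙 (toℕ k ℕ.<? toℕ j)
  bottomPairs-at j k {e} e∈ with toℕ k ℕ.<? toℕ j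
  ... | yes k<j with a₀ , min₀ ← min-exists j = trans
    (∑𝟙-unique (λ a → bottomOf? j a ×-dec (toℕ e ℕ.<? toℕ a)) a₀
      ((NP.≤-<-trans z≤n k<j , min₀) , blocks-ordered y ely k j k<j e∈ (proj₁ min₀))
      (λ a ((_ , min) , _) → min-unique min min₀))
    (sym (𝟙-yes (toℕ k ℕ.<? toℕ j) k<j))
  ... | no k≮j = trans
    (∑𝟙-none (λ a → bottomOf? j a ×-dec (toℕ e ℕ.<? toℕ a))
      (λ a ((_ , a∈ , a-min) , e<a) → NP.<⇒≱ e<a (a≤e a∈ a-min)))
    (sym (𝟙-no (toℕ k ℕ.<? toℕ j) k≮j))
    where
    a≤e : ∀ {a} → a ∈ lookup y j → (∀ e → e ∈ lookup y j → toℕ a ≤ toℕ e) → toℕ a ≤ toℕ e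
    a≤e a∈ a-min with NP.<-cmp (toℕ j) (toℕ k)
    ... | tri< j<k _ _ = NP.<⇒≤ (blocks-ordered y ely j k j<k a∈ e∈)
    ... | tri≈ _ j≡k _ = a-min _ (subst (λ z → e ∈ lookup y z) (sym (FP.toℕ-injective j≡k)) e∈)
    ... | tri> _ _ k<j = ⊥-elim (k≮j k<j)

  pairs-at : ∀ j k {e} → e ∈ lookup y k → ∑ℕ (λ a → topPair j a e + bottomPair j a e) ≡ 𝟙 (¬? (j FP.≟ k))
  pairs-at j k {e} e∈ = begin
    ∑ℕ (λ a → topPair j a e + bottomPair j a e)
      ≡⟨ ℕSum.∑-distrib-+ (λ a → topPair j a e) (λ a → bottomPair j a e) ⟩
    ∑ℕ (λ a → topPair j a e) + ∑ℕ (λ a → bottomPair j a e)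
      ≡⟨ cong₂ _+_ (topPairs-at j k e∈) (bottomPairs-at j k e∈) ⟩
    𝟙 (toℕ j ℕ.<? toℕ k) + 𝟙 (toℕ k ℕ.<? toℕ j)           ≡⟨ trichotomy ⟩
    𝟙 (¬? (j FP.≟ k))                                       ∎
    where
    open ≡-Reasoning
    trichotomy : 𝟙 (toℕ j ℕ.<? toℕ k) + 𝟙 (toℕ k ℕ.<? toℕ j) ≡ 𝟙 (¬? (j FP.≟ k))
    trichotomy with NP.<-cmp (toℕ j) (toℕ k)
    ... | tri< j<k j≢k _ rewrite 𝟙-yes (toℕ j ℕ.<? toℕ k) j<k | 𝟙-no (toℕ k ℕ.<? toℕ j) (NP.<⇒≯ j<k)
                               | 𝟙-yes (¬? (j FP.≟ k)) (j≢k ∘ cong toℕ) = refl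
    ... | tri≈ j≮k j≡k _ rewrite 𝟙-no (toℕ j ℕ.<? toℕ k) j≮k | 𝟙-no (toℕ k ℕ.<? toℕ j) (NP.<-irrefl (sym j≡k))
                               | 𝟙-no (¬? (j FP.≟ k)) (λ j≢k → j≢k (FP.toℕ-injective j≡k)) = refl
    ... | tri> _ j≢k k<j rewrite 𝟙-no (toℕ j ℕ.<? toℕ k) (NP.<⇒≯ k<j) | 𝟙-yes (toℕ k ℕ.<? toℕ j) k<j
                               | 𝟙-yes (¬? (j FP.≟ k)) (j≢k ∘ cong toℕ) = refl

  other-blocks : ∀ k → ∑ℕ (λ j → 𝟙 (¬? (j FP.≟ k))) ≡ l
  other-blocks k = begin
    ∑ℕ (λ j → 𝟙 (¬? (j FP.≟ k)))                            ≡⟨ ℕSum.sum-remove {l} {k} (λ j → 𝟙 (¬? (j FP.≟ k))) ⟩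
    𝟙 (¬? (k FP.≟ k)) + ∑ℕ (λ i → 𝟙 (¬? (punchIn k i FP.≟ k))) ≡⟨ cong₂ _+_ (𝟙-no (¬? (k FP.≟ k)) (λ k≢k → k≢k refl))
                                                                      (ℕSum.sum-cong-≗ ones) ⟩
    ∑ℕ {l} (λ _ → 1)                                         ≡⟨ ∑ℕ-ones l ⟩
    l                                                        ∎
    where
    open ≡-Reasoning
    ones : ∀ i → 𝟙 (¬? (punchIn k i FP.≟ k)) ≡ 1
    ones i = 𝟙-yes (¬? (punchIn k i FP.≟ k)) (FP.punchInᵢ≢i k i)

  ∑-defect : ∑ℕ defect ≡ ∣ U ∣ * l
  ∑-defect = begin
    ∑ℕ (λ a → ∑ℕ (λ j → ∑ℕ (λ e → T a j e)))     ≡⟨ ℕSum.∑-comm (λ a j → ∑ℕ (λ e → T a j e)) ⟩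
    ∑ℕ (λ j → ∑ℕ (λ a → ∑ℕ (λ e → T a j e)))     ≡⟨ ℕSum.sum-cong-≗ (λ j → ℕSum.∑-comm (λ a e → T a j e)) ⟩
    ∑ℕ (λ j → ∑ℕ (λ e → ∑ℕ (λ a → T a j e)))     ≡⟨ ℕSum.∑-comm (λ j e → ∑ℕ (λ a → T a j e)) ⟩
    ∑ℕ (λ e → ∑ℕ (λ j → ∑ℕ (λ a → T a j e)))     ≡⟨ ℕSum.sum-cong-≗ factor ⟩
    ∑ℕ (λ e → χ U e * ∑ℕ (λ j → ∑ℕ (λ a → P j a e))) ≡⟨ ℕSum.sum-cong-≗ count ⟩
    ∑ℕ (λ e → χ U e * l)                         ≡⟨ ∑ℕ-*ʳ l (χ U) ⟩
    ∑ℕ (χ U) * l                                 ≡⟨ cong (_* l) (∣p∣≡∑χ U) ⟨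
    ∣ U ∣ * l                                    ∎
    where
    open ≡-Reasoning
    P : Fin (suc l) → Fin n → Fin n → ℕ
    P j a e = topPair j a e + bottomPair j a e
    T : Fin n → Fin (suc l) → Fin n → ℕ
    T a j e = χ U e * P j a e
    factor : ∀ e → ∑ℕ (λ j → ∑ℕ (λ a → T a j e)) ≡ χ U e * ∑ℕ (λ j → ∑ℕ (λ a → P j a e))
    factor e = trans (ℕSum.sum-cong-≗ (λ j → sym (*-distribˡ-sum (χ U e) (λ a → P j a e))))
                     (sym (*-distribˡ-sum (χ U e) (λ j → ∑ℕ (λ a → P j a e))))
    count : ∀ e → χ U e * ∑ℕ (λ j → ∑ℕ (λ a → P j a e)) ≡ χ U e * l
    count e with e ∈? U
    ... | no _   = refl
    ... | yes e∈ with k , e∈k ← ∈-⋃B⁻ y e∈ =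
      cong (1 *_) (trans (ℕSum.sum-cong-≗ (λ j → pairs-at j k e∈k)) (other-blocks k))

  defect-∉ : ∀ {a} → a ∉ U → defect a ≡ 0
  defect-∉ {a} a∉ = ℕSum.sum-zero _ (λ j → ℕSum.sum-zero _ (λ e →
    trans (cong (χ U e *_) (cong₂ _+_
            (𝟙-no (topOf? j a ×-dec (toℕ a ℕ.<? toℕ e)) (λ ((_ , a∈ , _) , _) → a∉ (∈-⋃B⁺ y j a∈)))
            (𝟙-no (bottomOf? j a ×-dec (toℕ e ℕ.<? toℕ a)) (λ ((_ , a∈ , _) , _) → a∉ (∈-⋃B⁺ y j a∈)))))
          (NP.*-zeroʳ (χ U e))))

  defect-∈ : ∀ {a} β → a ∈ lookup y β → defect a ≡ 𝟙 (topOf? β a) * above a + 𝟙 (bottomOf? β a) * below a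
  defect-∈ {a} β a∈ = begin
    defect a                                          ≡⟨ ℕSum.sum-point _ β other-block ⟩
    ∑ℕ (λ e → χ U e * (topPair β a e + bottomPair β a e)) ≡⟨ ℕSum.sum-cong-≗ pointwise ⟩
    ∑ℕ (λ e → t * (χ U e * 𝟙 (toℕ a ℕ.<? toℕ e)) + b * (χ U e * 𝟙 (toℕ e ℕ.<? toℕ a)))
      ≡⟨ ℕSum.∑-distrib-+ (λ e → t * (χ U e * 𝟙 (toℕ a ℕ.<? toℕ e))) (λ e → b * (χ U e * 𝟙 (toℕ e ℕ.<? toℕ a))) ⟩
    ∑ℕ (λ e → t * (χ U e * 𝟙 (toℕ a ℕ.<? toℕ e))) + ∑ℕ (λ e → b * (χ U e * 𝟙 (toℕ e ℕ.<? toℕ a)))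
      ≡⟨ cong₂ _+_ (*-distribˡ-sum t (λ e → χ U e * 𝟙 (toℕ a ℕ.<? toℕ e)))
                   (*-distribˡ-sum b (λ e → χ U e * 𝟙 (toℕ e ℕ.<? toℕ a))) ⟨
    t * above a + b * below a                         ∎
    where
    open ≡-Reasoning
    t = 𝟙 (topOf? β a)
    b = 𝟙 (bottomOf? β a)
    other-block : ∀ j → j ≢ β → ∑ℕ (λ e → χ U e * (topPair j a e + bottomPair j a e)) ≡ 0
    other-block j j≢β = ℕSum.sum-zero _ (λ e → trans (cong (χ U e *_) (cong₂ _+_
      (𝟙-no (topOf? j a ×-dec (toℕ a ℕ.<? toℕ e)) (λ ((_ , a∈j , _) , _) → j≢β (block-unique y ely j β a∈j a∈)))
      (𝟙-no (bottomOf? j a ×-dec (toℕ e ℕ.<? toℕ a)) (λ ((_ , a∈j , _) , _) → j≢β (block-unique y ely j β a∈j a∈)))))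
      (NP.*-zeroʳ (χ U e)))
    pointwise : ∀ e → χ U e * (topPair β a e + bottomPair β a e) ≡
                      t * (χ U e * 𝟙 (toℕ a ℕ.<? toℕ e)) + b * (χ U e * 𝟙 (toℕ e ℕ.<? toℕ a))
    pointwise e rewrite 𝟙-×-dec (topOf? β a) (toℕ a ℕ.<? toℕ e) | 𝟙-×-dec (bottomOf? β a) (toℕ e ℕ.<? toℕ a) =
      distribute (χ U e) t (𝟙 (toℕ a ℕ.<? toℕ e)) b (𝟙 (toℕ e ℕ.<? toℕ a))
      where
      distribute : ∀ c p q r s → c * (p * q + r * s) ≡ p * (c * q) + r * (c * s)
      distribute = solve-∀

  defect≤N : ∀ {a} → a ∈ U → defect a ≤ N
  defect≤N {a} a∈ with β , a∈β ← ∈-⋃B⁻ y a∈ = begin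
    defect a                                                  ≡⟨ defect-∈ β a∈β ⟩
    𝟙 (topOf? β a) * above a + 𝟙 (bottomOf? β a) * below a  ≤⟨ NP.+-mono-≤ (𝟙-*-≤ (topOf? β a) (above a))
                                                                            (𝟙-*-≤ (bottomOf? β a) (below a)) ⟩
    above a + below a                                         ≡⟨ NP.+-comm (above a) (below a) ⟩
    below a + above a                                         ≡⟨ below+above a∈ ⟩
    N                                                         ∎
    where open NP.≤-Reasoning

  weight+defect : ∀ a → weight a + defect a ≡ χ U a * N
  weight+defect a with a ∈? U
  ... | no a∉ = defect-∉ a∉
  ... | yes a∈ = trans (cong (_+ defect a) (NP.+-identityʳ (N ∸ defect a)))
                       (trans (NP.m∸n+n≡m (defect≤N a∈)) (sym (NP.+-identityʳ N)))

  ∑-weight : ∑ℕ weight ≡ ∣ U ∣ * (N ∸ l)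
  ∑-weight = begin
    ∑ℕ weight                                 ≡⟨ NP.m+n∸n≡m (∑ℕ weight) (∑ℕ defect) ⟨
    ∑ℕ weight + ∑ℕ defect ∸ ∑ℕ defect         ≡⟨ cong₂ _∸_ (sym (ℕSum.∑-distrib-+ weight defect)) ∑-defect ⟩
    ∑ℕ (λ a → weight a + defect a) ∸ ∣ U ∣ * l ≡⟨ cong (_∸ ∣ U ∣ * l) (ℕSum.sum-cong-≗ weight+defect) ⟩
    ∑ℕ (λ a → χ U a * N) ∸ ∣ U ∣ * l          ≡⟨ cong (_∸ ∣ U ∣ * l) (∑ℕ-*ʳ N (χ U)) ⟩
    ∑ℕ (χ U) * N ∸ ∣ U ∣ * l                  ≡⟨ cong (λ z → z * N ∸ ∣ U ∣ * l) (∣p∣≡∑χ U) ⟨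
    ∣ U ∣ * N ∸ ∣ U ∣ * l                     ≡⟨ NP.*-distribˡ-∸ ∣ U ∣ N l ⟨
    ∣ U ∣ * (N ∸ l)                           ∎
    where open ≡-Reasoning

  above≡0 : ∀ {β a} → IsMaxOf β a → ¬ toℕ β < l → above a ≡ 0
  above≡0 {β} {a} (a∈ , a-max) β≮l = ℕSum.sum-zero _ none
    where
    none : ∀ e → χ U e * 𝟙 (toℕ a ℕ.<? toℕ e) ≡ 0
    none e with e ∈? U
    ... | no _   = refl
    ... | yes e∈ with i , e∈i ← ∈-⋃B⁻ y e∈ = cong (_+ 0) (𝟙-no (toℕ a ℕ.<? toℕ e) a≮e)
      where
      a≮e : ¬ toℕ a < toℕ e
      a≮e a<e with NP.<-cmp (toℕ i) (toℕ β)
      ... | tri< i<β _ _ = NP.<-asym a<e (blocks-ordered y ely i β i<β e∈i a∈)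
      ... | tri≈ _ i≡β _ = NP.<⇒≱ a<e (a-max e (subst (λ z → e ∈ lookup y z) (FP.toℕ-injective i≡β) e∈i))
      ... | tri> _ _ β<i = β≮l (NP.<-≤-trans β<i (FP.toℕ≤pred[n] i))

  below≡0 : ∀ {β a} → IsMinOf β a → ¬ 0 < toℕ β → below a ≡ 0
  below≡0 {β} {a} (a∈ , a-min) β≯0 = ℕSum.sum-zero _ none
    where
    none : ∀ e → χ U e * 𝟙 (toℕ e ℕ.<? toℕ a) ≡ 0
    none e with e ∈? U
    ... | no _   = refl
    ... | yes e∈ with i , e∈i ← ∈-⋃B⁻ y e∈ = cong (_+ 0) (𝟙-no (toℕ e ℕ.<? toℕ a) e≮a)
      where
      e≮a : ¬ toℕ e < toℕ a
      e≮a e<a with NP.<-cmp (toℕ i) (toℕ β)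
      ... | tri< i<β _ _ = β≯0 (NP.≤-<-trans z≤n i<β)
      ... | tri≈ _ i≡β _ = NP.<⇒≱ e<a (a-min e (subst (λ z → e ∈ lookup y z) (FP.toℕ-injective i≡β) e∈i))
      ... | tri> _ _ β<i = NP.<-asym e<a (blocks-ordered y ely β i β<i a∈ e∈i)

  above≤top : ∀ {β a} → IsMaxOf β a → above a ≤ 𝟙 (topOf? β a) * above a
  above≤top {β} {a} max with toℕ β ℕ.<? l
  ... | yes β<l = NP.≤-reflexive (sym (trans (cong (_* above a) (𝟙-yes (topOf? β a) (β<l , max)))
                                             (NP.*-identityˡ (above a))))
  ... | no β≮l  = subst (_≤ 𝟙 (topOf? β a) * above a) (sym (above≡0 max β≮l)) z≤n

  below≤bottom : ∀ {β a} → IsMinOf β a → below a ≤ 𝟙 (bottomOf? β a) * below a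
  below≤bottom {β} {a} min with 0 ℕ.<? toℕ β
  ... | yes β>0 = NP.≤-reflexive (sym (trans (cong (_* below a) (𝟙-yes (bottomOf? β a) (β>0 , min)))
                                             (NP.*-identityˡ (below a))))
  ... | no β≯0  = subst (_≤ 𝟙 (bottomOf? β a) * below a) (sym (below≡0 min β≯0)) z≤n

  module Removal {a β} (a∈ : a ∈ lookup y β) where

    x : Blocks n l
    x = removeFrom y a β

    a∈U : a ∈ U
    a∈U = ∈-⋃B⁺ y β a∈

    ∣⋃B-removeFrom∣ : ∣ ⋃B x ∣ ≡ N
    ∣⋃B-removeFrom∣ = begin
      ∣ ⋃B x ∣                  ≡⟨ NP.m+n∸n≡m ∣ ⋃B x ∣ 1 ⟨
      ∣ ⋃B x ∣ + 1 ∸ 1          ≡⟨ cong (λ z → ∣ ⋃B x ∣ + z ∸ 1) (∣⁅x⁆∣≡1 a) ⟨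
      ∣ ⋃B x ∣ + ∣ ⁅ a ⁆ ∣ ∸ 1  ≡⟨ cong (_∸ 1) (∣p∣+∣q∣≡∣r∣ (⋃B x) ⁅ a ⁆ U disjoint covers x⊆ a⊆) ⟩
      N                         ∎
      where
      open ≡-Reasoning
      disjoint : ∀ {e} → e ∈ ⋃B x → e ∉ ⁅ a ⁆
      disjoint e∈ e∈a = ∉-removeFrom y a β ely a∈ (subst (_∈ ⋃B x) (x∈⁅y⁆⇒x≡y a e∈a) e∈)
      covers : ∀ {e} → e ∈ U → e ∈ ⋃B x ⊎ e ∈ ⁅ a ⁆
      covers {e} e∈ with i , e∈i ← ∈-⋃B⁻ y e∈ with e FP.≟ a
      ... | yes refl = inj₂ (x∈⁅x⁆ a)
      ... | no e≢a   = inj₁ (∈-⋃B⁺ x i (∈-removeFrom⁺ y a β i e∈i (λ _ → e≢a)))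
      x⊆ : ⋃B x ⊆ U
      x⊆ e∈ = let i , e∈i = ∈-⋃B⁻ x e∈ in ∈-⋃B⁺ y i (proj₁ (∈-removeFrom⁻ y a β i e∈i))
      a⊆ : ⁅ a ⁆ ⊆ U
      a⊆ e∈ = subst (_∈ U) (sym (x∈⁅y⁆⇒x≡y a e∈)) a∈U

    kept-below : ∀ {i e} → IsMaxOf β a → e ∈ lookup x i → toℕ i ≤ toℕ β → toℕ e < toℕ a
    kept-below {i} {e} (_ , a-max) e∈ i≤β with e∈y , kept ← ∈-removeFrom⁻ y a β i e∈ | NP.m≤n⇒m<n∨m≡n i≤β
    ... | inj₁ i<β = blocks-ordered y ely i β i<β e∈y a∈
    ... | inj₂ i≡β with refl ← FP.toℕ-injective i≡β =
      NP.≤∧≢⇒< (a-max e e∈y) (λ e≡a → kept refl (FP.toℕ-injective e≡a))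

    kept-above : ∀ {i e} → IsMinOf β a → e ∈ lookup x i → toℕ β ≤ toℕ i → toℕ a < toℕ e
    kept-above {i} {e} (_ , a-min) e∈ β≤i with e∈y , kept ← ∈-removeFrom⁻ y a β i e∈ | NP.m≤n⇒m<n∨m≡n β≤i
    ... | inj₁ β<i = blocks-ordered y ely β i β<i a∈ e∈y
    ... | inj₂ β≡i with refl ← FP.toℕ-injective β≡i =
      NP.≤∧≢⇒< (a-min e e∈y) (λ a≡e → kept refl (sym (FP.toℕ-injective a≡e)))

    ∣lowerUnion-removeFrom∣ : IsMaxOf β a → ∣ lowerUnion x β ∣ ≡ below a
    ∣lowerUnion-removeFrom∣ max = ∣p∣≡∑χ∧ (λ e → toℕ e ℕ.<? toℕ a) (lowerUnion x β) U sound complete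
      where
      sound : ∀ {e} → e ∈ lowerUnion x β → e ∈ U × toℕ e < toℕ a
      sound e∈ with i , i≤β , e∈i ← ∈-lowerUnion⁻ x β e∈ =
        ∈-⋃B⁺ y i (proj₁ (∈-removeFrom⁻ y a β i e∈i)) , kept-below max e∈i i≤β
      complete : ∀ {e} → e ∈ U → toℕ e < toℕ a → e ∈ lowerUnion x β
      complete e∈ e<a with i , e∈i ← ∈-⋃B⁻ y e∈ with toℕ i ℕ.≤? toℕ β
      ... | yes i≤β = ∈-lowerUnion⁺ x β i i≤β
                        (∈-removeFrom⁺ y a β i e∈i (λ _ e≡a → NP.<-irrefl (cong toℕ e≡a) e<a))
      ... | no  i≰β = ⊥-elim (NP.<-asym e<a (blocks-ordered y ely β i (NP.≰⇒> i≰β) a∈ e∈i))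

    ∣upperUnion-removeFrom∣ : IsMinOf β a → ∣ upperUnion x β ∣ ≡ above a
    ∣upperUnion-removeFrom∣ min = ∣p∣≡∑χ∧ (λ e → toℕ a ℕ.<? toℕ e) (upperUnion x β) U sound complete
      where
      sound : ∀ {e} → e ∈ upperUnion x β → e ∈ U × toℕ a < toℕ e
      sound e∈ with i , β≤i , e∈i ← ∈-upperUnion⁻ x β e∈ =
        ∈-⋃B⁺ y i (proj₁ (∈-removeFrom⁻ y a β i e∈i)) , kept-above min e∈i β≤i
      complete : ∀ {e} → e ∈ U → toℕ a < toℕ e → e ∈ upperUnion x β
      complete e∈ a<e with i , e∈i ← ∈-⋃B⁻ y e∈ with toℕ β ℕ.≤? toℕ i
      ... | yes β≤i = ∈-upperUnion⁺ x β i β≤i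
                        (∈-removeFrom⁺ y a β i e∈i (λ _ e≡a → NP.<-irrefl (cong toℕ (sym e≡a)) a<e))
      ... | no  β≰i = ⊥-elim (NP.<-asym a<e (blocks-ordered y ely i β (NP.≰⇒> β≰i) e∈i a∈))

    isElem-y : IsElem (addTo x a β)
    isElem-y = subst IsElem (sym (addTo-removeFrom y a β a∈)) ely

    fits-above⇒topOf : ∀ {k} → Fits x a k → toℕ β < toℕ k → TopOf β a
    fits-above⇒topOf {k} fits β<k = NP.<-≤-trans β<k (FP.toℕ≤pred[n] k) , a∈ , a-max
      where
      a-max : ∀ e → e ∈ lookup y β → toℕ e ≤ toℕ a
      a-max e e∈ with e FP.≟ a
      ... | yes refl = NP.≤-refl
      ... | no e≢a   = NP.<⇒≤ (proj₁ (fits β (∈-removeFrom⁺ y a β β e∈ (λ _ → e≢a))) β<k)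

    fits-below⇒bottomOf : ∀ {k} → Fits x a k → toℕ k < toℕ β → BottomOf β a
    fits-below⇒bottomOf {k} fits k<β = NP.≤-<-trans z≤n k<β , a∈ , a-min
      where
      a-min : ∀ e → e ∈ lookup y β → toℕ a ≤ toℕ e
      a-min e e∈ with e FP.≟ a
      ... | yes refl = NP.≤-refl
      ... | no e≢a   = NP.<⇒≤ (proj₂ (fits β (∈-removeFrom⁺ y a β β e∈ (λ _ → e≢a))) k<β)

    topOf⇒fits-next : TopOf β a → ∃[ k ] (toℕ k ≡ suc (toℕ β) × Fits x a k)
    topOf⇒fits-next (β<l , max) = k , k≡β+1 , λ i e∈ →
      (λ i<k → kept-below max e∈ (NP.≤-pred (subst (toℕ i <_) k≡β+1 i<k))) ,
      (λ k<i → blocks-ordered y ely β i (NP.<-trans (subst (toℕ β <_) (sym k≡β+1) (NP.n<1+n _)) k<i)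
                                        a∈ (proj₁ (∈-removeFrom⁻ y a β i e∈)))
      where
      k = Fin.fromℕ< (s≤s β<l)
      k≡β+1 = FP.toℕ-fromℕ< (s≤s β<l)

    bottomOf⇒fits-previous : BottomOf β a → ∃[ k ] (suc (toℕ k) ≡ toℕ β × Fits x a k)
    bottomOf⇒fits-previous (β>0 , min) = Fin.pred β , k+1≡β , λ i e∈ →
      (λ i<k → blocks-ordered y ely i β (NP.<-trans i<k (NP.≤-reflexive k+1≡β))
                              (proj₁ (∈-removeFrom⁻ y a β i e∈)) a∈) ,
      (λ k<i → kept-above min e∈ (subst (_≤ toℕ i) k+1≡β k<i))
      where
      k+1≡β = suc-toℕ-pred β β>0

    weight-eval : ∀ t b → 𝟙 (topOf? β a) ≡ t → 𝟙 (bottomOf? β a) ≡ b →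
                  weight a ≡ N ∸ (t * above a + b * below a)
    weight-eval t b t≡ b≡ = begin
      χ U a * (N ∸ defect a)                                            ≡⟨ cong (_* (N ∸ defect a)) (χ-∈ a∈U) ⟩
      1 * (N ∸ defect a)                                                ≡⟨ NP.*-identityˡ (N ∸ defect a) ⟩
      N ∸ defect a                                                      ≡⟨ cong (N ∸_) (defect-∈ β a∈) ⟩
      N ∸ (𝟙 (topOf? β a) * above a + 𝟙 (bottomOf? β a) * below a)
                                                                        ≡⟨ cong₂ (λ t b → N ∸ (t * above a + b * below a)) t≡ b≡ ⟩
      N ∸ (t * above a + b * below a)                                   ∎
      where open ≡-Reasoning

    weight-isolated : ¬ IsElem x → weight a ≡ 0
    weight-isolated ¬elx = trans (weight-eval _ _ refl refl) (NP.m≤n⇒m∸n≡0 (begin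
      N                                                              ≡⟨ below+above a∈U ⟨
      below a + above a                                              ≡⟨ NP.+-comm (below a) (above a) ⟩
      above a + below a                                              ≤⟨ NP.+-mono-≤ (above≤top max) (below≤bottom min) ⟩
      𝟙 (topOf? β a) * above a + 𝟙 (bottomOf? β a) * below a       ∎))
      where
      open NP.≤-Reasoning
      only-a : ∀ e → e ∈ lookup y β → e ≡ a
      only-a e e∈ with e FP.≟ a
      ... | yes e≡a = e≡a
      ... | no  e≢a = ⊥-elim (¬elx (removeFrom-isElem y a β ely e∈ e≢a))
      max : IsMaxOf β a
      max = a∈ , λ e e∈ → NP.≤-reflexive (cong toℕ (only-a e e∈))
      min : IsMinOf β a
      min = a∈ , λ e e∈ → NP.≤-reflexive (cong toℕ (sym (only-a e e∈)))

    module _ (elx : IsElem x) where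

      N>0 : 0 < N
      N>0 = subst (0 <_) ∣⋃B-removeFrom∣ (∣⋃B∣>0 x elx)

      ¬top×bottom : ¬ (TopOf β a × BottomOf β a)
      ¬top×bottom ((_ , _ , a-max) , (_ , _ , a-min)) with e , e∈ ← proj₁ elx β
        with e∈y , kept ← ∈-removeFrom⁻ y a β β e∈ =
        kept refl (FP.toℕ-injective (NP.≤-antisym (a-max e e∈y) (a-min e e∈y)))

      fAdd-top : TopOf β a → ¬ BottomOf β a → fAdd x a β ≡ frac (weight a) N
      fAdd-top top ¬bottom with k , k≡β+1 , fits-k ← topOf⇒fits-next top = begin
        fAdd x a β                               ≡⟨ fAdd-lower x a β k two el-k β<k ⟩
        frac (∣ lowerUnion x β ∣) (∣ ⋃B x ∣)     ≡⟨ cong₂ frac (∣lowerUnion-removeFrom∣ (proj₂ top)) ∣⋃B-removeFrom∣ ⟩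
        frac (below a) N                         ≡⟨ cong (λ w → frac w N) weight≡below ⟨
        frac (weight a) N                        ∎
        where
        open ≡-Reasoning
        β<k = subst (toℕ β <_) (sym k≡β+1) (NP.n<1+n _)
        el-k = fits⇒isElem-addTo x a k elx fits-k
        two = length-filter-allFin≢1 (λ j → isElem? (addTo x a j)) β k isElem-y el-k
                                     (λ β≡k → NP.<-irrefl (cong toℕ β≡k) β<k)
        weight≡below : weight a ≡ below a
        weight≡below = begin
          weight a                       ≡⟨ weight-eval 1 0 (𝟙-yes (topOf? β a) top) (𝟙-no (bottomOf? β a) ¬bottom) ⟩
          N ∸ (1 * above a + 0 * below a) ≡⟨ cong (N ∸_) (trans (NP.+-identityʳ _) (NP.*-identityˡ (above a))) ⟩
          N ∸ above a                    ≡⟨ cong (_∸ above a) (below+above a∈U) ⟨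
          below a + above a ∸ above a    ≡⟨ NP.m+n∸n≡m (below a) (above a) ⟩
          below a                        ∎

      fAdd-bottom : ¬ TopOf β a → BottomOf β a → fAdd x a β ≡ frac (weight a) N
      fAdd-bottom ¬top bottom with k , k+1≡β , fits-k ← bottomOf⇒fits-previous bottom = begin
        fAdd x a β                               ≡⟨ fAdd-upper x a β two none-above ⟩
        frac (∣ upperUnion x β ∣) (∣ ⋃B x ∣)     ≡⟨ cong₂ frac (∣upperUnion-removeFrom∣ (proj₂ bottom)) ∣⋃B-removeFrom∣ ⟩
        frac (above a) N                         ≡⟨ cong (λ w → frac w N) weight≡above ⟨
        frac (weight a) N                        ∎
        where
        open ≡-Reasoning
        k<β = NP.≤-reflexive k+1≡β
        el-k = fits⇒isElem-addTo x a k elx fits-k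
        two = length-filter-allFin≢1 (λ j → isElem? (addTo x a j)) k β el-k isElem-y
                                     (λ k≡β → NP.<-irrefl (cong toℕ k≡β) k<β)
        none-above : ∀ j → toℕ β < toℕ j → ¬ IsElem (addTo x a j)
        none-above j β<j el-j = ¬top (fits-above⇒topOf (isElem-addTo⇒fits x a j el-j) β<j)
        weight≡above : weight a ≡ above a
        weight≡above = begin
          weight a                       ≡⟨ weight-eval 0 1 (𝟙-no (topOf? β a) ¬top) (𝟙-yes (bottomOf? β a) bottom) ⟩
          N ∸ (0 * above a + 1 * below a) ≡⟨ cong (N ∸_) (NP.*-identityˡ (below a)) ⟩
          N ∸ below a                    ≡⟨ cong (_∸ below a) (below+above a∈U) ⟨
          below a + above a ∸ below a    ≡⟨ NP.m+n∸m≡n (below a) (above a) ⟩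
          above a                        ∎

      fAdd-inner : ¬ TopOf β a → ¬ BottomOf β a → fAdd x a β ≡ frac (weight a) N
      fAdd-inner ¬top ¬bottom = begin
        fAdd x a β         ≡⟨ fAdd-single x a β
                                (length-filter-allFin≡1 (λ j → isElem? (addTo x a j)) β isElem-y only-β) ⟩
        1ℚ                 ≡⟨ frac-self N>0 ⟨
        frac N N           ≡⟨ cong (λ w → frac w N)
                                (weight-eval 0 0 (𝟙-no (topOf? β a) ¬top) (𝟙-no (bottomOf? β a) ¬bottom)) ⟨
        frac (weight a) N  ∎
        where
        open ≡-Reasoning
        only-β : ∀ k → IsElem (addTo x a k) → k ≡ β
        only-β k el-k with NP.<-cmp (toℕ k) (toℕ β)
        ... | tri< k<β _ _ = ⊥-elim (¬bottom (fits-below⇒bottomOf (isElem-addTo⇒fits x a k el-k) k<β))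
        ... | tri≈ _ k≡β _ = FP.toℕ-injective k≡β
        ... | tri> _ _ β<k = ⊥-elim (¬top (fits-above⇒topOf (isElem-addTo⇒fits x a k el-k) β<k))

      fAdd-removeFrom : fAdd x a β ≡ frac (weight a) N
      fAdd-removeFrom with topOf? β a | bottomOf? β a
      ... | yes top | yes bottom = ⊥-elim (¬top×bottom (top , bottom))
      ... | yes top | no ¬bottom = fAdd-top top ¬bottom
      ... | no ¬top | yes bottom = fAdd-bottom ¬top bottom
      ... | no ¬top | no ¬bottom = fAdd-inner ¬top ¬bottom

    inflow-term : when (cover? x y) (flowR n l x y) ≡ frac (weight a) N
    inflow-term = by-cases (isElem? x)
      where
      open ≡-Reasoning
      by-cases : Dec (IsElem x) → when (cover? x y) (flowR n l x y) ≡ frac (weight a) N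
      by-cases (yes elx) = begin
        when (cover? x y) (flowR n l x y) ≡⟨ when-yes (cover? x y) (flowR n l x y) c ⟩
        flowR n l x y                     ≡⟨ flowR-removeFrom y a β c ⟩
        fAdd x a β                        ≡⟨ fAdd-removeFrom elx ⟩
        frac (weight a) N                 ∎
        where c = removeFrom-cover y a β ely a∈ elx
      by-cases (no ¬elx) = begin
        when (cover? x y) (flowR n l x y) ≡⟨ when-no (cover? x y) (flowR n l x y) (¬elx ∘ proj₁) ⟩
        0ℚ                                ≡⟨ frac-zero N ⟨
        frac 0 N                          ≡⟨ cong (λ w → frac w N) (weight-isolated ¬elx) ⟨
        frac (weight a) N                 ∎

  inflow-element : ∀ a → ∑ℚ (λ j → when (cover? (removeFrom y a j) y) (flowR n l (removeFrom y a j) y)) ≡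
                         frac (weight a) N
  inflow-element a = by-cases (a ∈? U)
    where
    open ≡-Reasoning
    term : Fin (suc l) → ℚ
    term j = when (cover? (removeFrom y a j) y) (flowR n l (removeFrom y a j) y)
    a∈block : ∀ j → Cover (removeFrom y a j) y → a ∈ lookup y j
    a∈block j = cover-removeFrom⇒∈ y a j
    by-cases : Dec (a ∈ U) → ∑ℚ term ≡ frac (weight a) N
    by-cases (yes a∈U) with β , a∈β ← ∈-⋃B⁻ y a∈U =
      trans (ℚSum.sum-point term β elsewhere) (Removal.inflow-term a∈β)
      where
      elsewhere : ∀ j → j ≢ β → term j ≡ 0ℚ
      elsewhere j j≢β = when-no (cover? (removeFrom y a j) y) (flowR n l (removeFrom y a j) y)
                                (λ c → j≢β (block-unique y ely j β (a∈block j c) a∈β))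
    by-cases (no a∉U) = begin
      ∑ℚ term              ≡⟨ ℚSum.sum-zero term none ⟩
      0ℚ                   ≡⟨ frac-zero N ⟨
      frac 0 N             ≡⟨ cong (λ w → frac (w * (N ∸ defect a)) N) (χ-∉ a∉U) ⟨
      frac (weight a) N    ∎
      where
      none : ∀ j → term j ≡ 0ℚ
      none j = when-no (cover? (removeFrom y a j) y) (flowR n l (removeFrom y a j) y)
                       (λ c → a∉U (∈-⋃B⁺ y j (a∈block j c)))

  inflow : sumℚ (map (λ x → flowR n l x y) (downCovers y)) ≡ frac (∣ U ∣ * (N ∸ l)) N
  inflow = begin
    sumℚ (map (λ x → flowR n l x y) (downCovers y))
      ≡⟨ sumℚ-filter-pairs _≟B_ (λ x → cover? x y) _ (λ x → flowR n l x y) injective ⟩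
    ∑ℚ (λ a → ∑ℚ (λ j → when (cover? (removeFrom y a j) y) (flowR n l (removeFrom y a j) y)))
      ≡⟨ ℚSum.sum-cong-≗ inflow-element ⟩
    ∑ℚ (λ a → frac (weight a) N) ≡⟨ ∑ℚ-frac weight N ⟩
    frac (∑ℕ weight) N           ≡⟨ cong (λ w → frac w N) ∑-weight ⟩
    frac (∣ U ∣ * (N ∸ l)) N     ∎
    where
    open ≡-Reasoning
    injective : ∀ a j b k → Cover (removeFrom y a j) y → Cover (removeFrom y b k) y →
                removeFrom y a j ≡ removeFrom y b k → a ≡ b × j ≡ k
    injective a j b k = removeFrom-injective y

  inflow-of-rank : ∀ r → rank y ≡ suc r →
                   sumℚ (map (λ x → flowR n l x y) (downCovers y)) ≡ frac ((suc r + l) * r) (r + l)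
  inflow-of-rank r rank≡ = trans inflow (cong₂ frac (cong₂ _*_ ∣U∣≡ N∸l≡) N≡)
    where
    ∣U∣≡ : ∣ U ∣ ≡ suc r + l
    ∣U∣≡ = m∸n≡1+r⇒m≡1+r+n _ l rank≡
    N≡ : N ≡ r + l
    N≡ = cong (_∸ 1) ∣U∣≡
    N∸l≡ : N ∸ l ≡ r
    N∸l≡ = trans (cong (_∸ l) N≡) (NP.m+n∸n≡m r l)

theorem4p7 : (n l : ℕ) → l < n → IsNormalizedFlow n l (flowR n l)
theorem4p7 n l l<n = (λ x y _ → flowR-nonneg x y) , nf1 , nf2
  where
  nf1 : ∀ r → 1 ≤ r → r ≤ (n ∸ l) ∸ 1 → Σ ℚ λ c → 0ℚ ℚ.< c ×
          (∀ x → IsElem x → rank x ≡ r → sumℚ (map (flowR n l x) (upCovers x)) ≡ c)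
  nf1 (suc r) _ r≤ =
    frac (n ∸ (suc r + l)) 1 ,
    frac-pos (n ∸ (suc r + l)) 1 (NP.m<n⇒0<n∸m (r+l<n l<n r≤)) (s≤s z≤n) ,
    λ x el → Outflow.outflow-of-rank x el r
  nf2 : ∀ r → 1 ≤ r → r ≤ (n ∸ l) ∸ 1 → Σ ℚ λ c → 0ℚ ℚ.< c ×
          (∀ y → IsElem y → rank y ≡ suc r → sumℚ (map (λ x → flowR n l x y) (downCovers y)) ≡ c)
  nf2 (suc r) _ _ =
    frac ((2 + r + l) * suc r) (suc r + l) ,
    frac-pos ((2 + r + l) * suc r) (suc r + l) (s≤s z≤n) (s≤s z≤n) ,
    λ y el → Inflow.inflow-of-rank y el (suc r)
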